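{- Let $n\ge1$, $k\ge1$, $w\in\mathfrak{S}_n$, and $d$ an integer with $0<d<kn$; let $m=kn/\gcd(kn,d)$. The number of $(w,g^d)$-equivariant functions $f:[n]\to[kn]\cup\{0\}$ equals $$\sum_{\pi} kn(kn-m)(kn-2m)\cdots(kn-(r_\pi-1)m),$$ where the sum is over all $(w,m)$-admissible set partitions $\pi$ of $[n]$ and $r_\pi$ is the number of $w$-orbits of blocks of $\pi$ having length $m$.
   Context: Identify $g$ with the permutation of $[kn]\cup\{0\}$ that cyclically permutes $1\to2\to\cdots\to kn\to1$ and fixes $0$. A function $f:[n]\to[kn]\cup\{0\}$ is $(w,g^d)$-equivariant if $f(w(j))=g^d(f(j))$ for all $j\in[n]$. A set partition $\pi=\{A_1,A_2,\dots\}$ of $[n]$ is $(w,m)$-admissible if (i) $w(\pi)=\{w(A_1),w(A_2),\dots\}=\pi$; (ii) at most one block $A_{i_0}$ satisfies $w(A_{i_0})=A_{i_0}$; (iii) every other block $A_i$ lies in a $w$-orbit of length exactly $m$, i.e. $A_i,w(A_i),\dots,w^{m-1}(A_i)$ are pairwise distinct and $w^m(A_i)=A_i$. An empty product (when $r_\pi=0$) equals $1$. -}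

module Defs where

open import Data.Nat using (ℕ; zero; suc; _+_; _*_; _∸_; _≤ᵇ_; _<ᵇ_)
open import Data.Nat.DivMod using (_%_; m%n<n)
open import Data.Bool using (Bool; true; false; _∧_; _∨_; not; _xor_; if_then_else_)
open import Data.Fin using (Fin; zero; suc; toℕ; fromℕ<; _≟_)
open import Data.Fin.Permutation using (Permutation′; _⟨$⟩ʳ_; _⟨$⟩ˡ_)
open import Data.List using (List; []; _∷_; map; concatMap; length; filterᵇ; allFin; upTo)
open import Data.Bool.ListAction using (all; any)
open import Data.Nat.ListAction using (sum; product)
open import Relation.Nullary.Decidable using (⌊_⌋)

allFunsFrom : {A : Set} → List A → (n : ℕ) → List (Fin n → A)
allFunsFrom xs zero    = (λ ()) ∷ []
allFunsFrom xs (suc n) =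
  concatMap (λ f → map (λ a → cons a f) xs) (allFunsFrom xs n)
  where
  cons : _ → (Fin n → _) → Fin (suc n) → _
  cons a f zero    = a
  cons a f (suc i) = f i

-- all functions [n] → [N] ∪ {0}  (Fin (suc N); 0 is `zero`, j ∈ [N] is `suc (j-1)`)
allFuns : (n N : ℕ) → List (Fin n → Fin N)
allFuns n N = allFunsFrom (allFin N) n

-- The permutation g of [N] ∪ {0}: 1 → 2 → ⋯ → N → 1, fixing 0.

cyc : ∀ {N} → Fin N → Fin N
cyc {suc N} i = fromℕ< (m%n<n (suc (toℕ i)) (suc N))

g : ∀ {N} → Fin (suc N) → Fin (suc N)
g zero    = zero
g (suc i) = suc (cyc i)

_^[_] : {A : Set} → (A → A) → ℕ → A → A
(h ^[ zero ])  x = x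
(h ^[ suc d ]) x = h ((h ^[ d ]) x)

_==_ : ∀ {N} → Fin N → Fin N → Bool
i == j = ⌊ i ≟ j ⌋

isEquivariant : ∀ {n N} → Permutation′ n → ℕ → (Fin n → Fin (suc N)) → Bool
isEquivariant {n} w d f =
  all (λ j → f (w ⟨$⟩ʳ j) == (g ^[ d ]) (f j)) (allFin n)

numEquivariant : (n k : ℕ) → Permutation′ n → ℕ → ℕ
numEquivariant n k w d = length (filterᵇ (isEquivariant w d) (allFuns n (suc (k * n))))

Subset : ℕ → Set
Subset n = Fin n → Bool

sameSet : ∀ {n} → Subset n → Subset n → Bool
sameSet {n} A B = all (λ j → not (A j xor B j)) (allFin n)

img : ∀ {n} → Permutation′ n → Subset n → Subset n
img w A j = A (w ⟨$⟩ˡ j)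

-- Set partitions of [n], encoded (bijectively) as equivalence relations:
-- R i j = true  iff  i and j lie in the same block.  The block of i is R i.

Rel₂ : ℕ → Set
Rel₂ n = Fin n → Fin n → Bool

isEquivRel : ∀ {n} → Rel₂ n → Bool
isEquivRel {n} R =
  all (λ i → R i i) (allFin n) ∧
  all (λ i → all (λ j → not (R i j) ∨ R j i) (allFin n)) (allFin n) ∧
  all (λ i → all (λ j → all (λ l → not (R i j ∧ R j l) ∨ R i l)
                                 (allFin n)) (allFin n)) (allFin n)

setPartitions : (n : ℕ) → List (Rel₂ n)
setPartitions n =
  filterᵇ isEquivRel (allFunsFrom (allFunsFrom (true ∷ false ∷ []) n) n)

isLeast : ∀ {n} → Rel₂ n → Fin n → Bool
isLeast {n} R i = all (λ j → not (R i j) ∨ (toℕ i ≤ᵇ toℕ j)) (allFin n)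

-- the list of blocks of π (each block listed once, via its least element)
blocks : ∀ {n} → Rel₂ n → List (Subset n)
blocks {n} R = map R (filterᵇ (isLeast R) (allFin n))

isBlock : ∀ {n} → Rel₂ n → Subset n → Bool
isBlock R A = any (sameSet A) (blocks R)

isInvariant : ∀ {n} → Permutation′ n → Rel₂ n → Bool
isInvariant w R =
  all (λ A → isBlock R (img w A)) (blocks R) ∧
  all (λ B → any (λ A → sameSet (img w A) B) (blocks R)) (blocks R)

isFixed : ∀ {n} → Permutation′ n → Subset n → Bool
isFixed w A = sameSet (img w A) A

orbitLengthExactly : ∀ {n} → Permutation′ n → ℕ → Subset n → Bool
orbitLengthExactly w m A =
  all (λ s → all (λ t → (s Data.Nat.≡ᵇ t) ∨
                          not (sameSet ((img w ^[ s ]) A) ((img w ^[ t ]) A)))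
                 (upTo m)) (upTo m)
  ∧ sameSet ((img w ^[ m ]) A) A

isAdmissible : ∀ {n} → Permutation′ n → ℕ → Rel₂ n → Bool
isAdmissible w m R =
  isInvariant w R ∧
  (length (filterᵇ (isFixed w) (blocks R)) ≤ᵇ 1) ∧
  all (λ A → isFixed w A ∨ orbitLengthExactly w m A) (blocks R)

-- r_π : number of w-orbits of blocks of π having length m.
-- Each orbit is counted once, through the unique block of the orbit that
-- contains the least element of the union of the orbit.
containsOrbitMin : ∀ {n} → Permutation′ n → ℕ → Subset n → Bool
containsOrbitMin {n} w m A =
  any (λ i → A i ∧
        all (λ t → all (λ j → not ((img w ^[ t ]) A j) ∨ (toℕ i ≤ᵇ toℕ j))
                       (allFin n)) (upTo m))
      (allFin n)

r : ∀ {n} → Permutation′ n → ℕ → Rel₂ n → ℕ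
r w m R = length (filterᵇ (λ A → orbitLengthExactly w m A ∧ containsOrbitMin w m A)
                          (blocks R))

fallingProd : (N m r : ℕ) → ℕ
fallingProd N m r = product (map (λ i → N ∸ i * m) (upTo r))

rhs : (n k : ℕ) → Permutation′ n → ℕ → ℕ
rhs n k w m =
  sum (map (λ R → fallingProd (k * n) m (r w m R))
           (filterᵇ (isAdmissible w m) (setPartitions n)))

module Submission where

-- Write N = kn, G = g^d (acting on [N] ∪ {0}) and π = w (acting on [n]).  G fixes 0
-- and, because m = N / gcd(N,d), every nonzero point lies in a G-orbit of exactly m
-- points.  An equivariant f determines its kernel partition {f a = f b}; this partition
-- is (w,m)-admissible: the block f⁻¹(0) is the only w-stable block, every other block
-- has a w-orbit of length exactly m.  Conversely, fix an admissible partition and call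
-- an element i a representative if it is the least element of the union of the orbit of
-- its block (there are r_π of them).  Equivariant functions with this kernel correspond
-- bijectively to assignments of nonzero values to the representatives lying in pairwise
-- distinct G-orbits, and there are N (N - m) ⋯ (N - (r_π - 1) m) such assignments.

open import Defs
open import Data.Bool using (Bool; true; false; _∧_; _∨_; not; _xor_; if_then_else_; T; T?)
open import Data.Bool.Properties using (∧-identityʳ; ∧-zeroʳ)
open import Data.Bool.ListAction using (all; any)
open import Data.Empty using (⊥; ⊥-elim)
open import Data.Fin using (Fin; zero; suc; toℕ; fromℕ<; _≟_)
open import Data.Fin.Properties using (toℕ-fromℕ<; toℕ-injective; toℕ<n) renaming (suc-injective to fsuc-injective)
open import Data.Fin.Permutation using (Permutation′; _⟨$⟩ʳ_; _⟨$⟩ˡ_; inverseˡ; inverseʳ)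
open import Data.List using (List; []; _∷_; map; concatMap; concat; length; filterᵇ; allFin; upTo; tabulate; _++_)
open import Data.List.Properties using (map-tabulate; applyUpTo-∷ʳ; map-++; length-map; length-tabulate; map-∘; map-id; ∷-injective)
open import Data.List.Membership.Propositional using (_∈_)
open import Data.List.Membership.Propositional.Properties using (∈-allFin; ∈-upTo⁺; ∈-upTo⁻; ∈-map⁺; ∈-map⁻; ∈-concat⁻′; ∈-filter⁺; ∈-filter⁻)
open import Data.List.Relation.Unary.Any using (here; there)
open import Data.List.Relation.Unary.AllPairs using (_∷_)
open import Data.List.Relation.Unary.Unique.Propositional using (Unique)
open import Data.List.Relation.Unary.Unique.Propositional.Properties using (allFin⁺; filter⁺; Unique[x∷xs]⇒x∉xs)
open import Data.Maybe using (Maybe; just; nothing; fromMaybe)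
open import Data.Maybe.Properties using (just-injective)
open import Data.Nat using (ℕ; zero; suc; _+_; _*_; _∸_; _≤_; _<_; z≤n; s≤s; NonZero; _%_; _/_; _≤ᵇ_; _≡ᵇ_; >-nonZero; ≢-nonZero; ≢-nonZero⁻¹; >-nonZero⁻¹) renaming (_≟_ to _≟ℕ_)
open import Data.Nat.Properties hiding (_≟_)
open import Algebra.Properties.CommutativeSemigroup +-commutativeSemigroup using (interchange)
open import Algebra.Properties.CommutativeSemigroup *-commutativeSemigroup using (x∙yz≈y∙xz)
open import Data.Nat.DivMod using (m%n<n; m≡m%n+[m/n]*n; m<n⇒m%n≡m; %-distribˡ-+; [m+kn]%n≡m%n; m%n%n≡m%n)
open import Data.Nat.Divisibility using (_∣_; divides; quotient; *-cancelʳ-∣; ∣⇒≤; ∣-refl; n∣m*n)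
open import Data.Nat.GCD using (gcd; gcd-GCD; GCD-*; gcd[m,n]∣n; gcd[m,n]≡0⇒n≡0; GCD)
open import Data.Nat.Coprimality using (Coprime; GCD≡1⇒coprime; coprime-divisor)
open import Data.Nat.ListAction using (sum; product)
open import Data.Nat.ListAction.Properties using (product-++)
open import Data.Product using (Σ; _×_; _,_; proj₁; proj₂)
open import Data.Sum using (_⊎_; inj₁; inj₂)
open import Data.Unit using (⊤; tt)
open import Function using (_∘_)
open import Relation.Binary.PropositionalEquality
open import Relation.Nullary using (¬_; yes; no)

T∧ : ∀ {a b} → T a → T b → T (a ∧ b)
T∧ {true} {true} _ _ = tt

T∧⁻ : ∀ {a b} → T (a ∧ b) → T a × T b
T∧⁻ {true} {true} t = tt , tt

T∨ˡ : ∀ {a} b → T a → T (a ∨ b)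
T∨ˡ {true} b t = tt

T∨ʳ : ∀ a {b} → T b → T (a ∨ b)
T∨ʳ true t = tt
T∨ʳ false t = t

T∨⁻ : ∀ {a b} → T (a ∨ b) → T a ⊎ T b
T∨⁻ {true} t = inj₁ tt
T∨⁻ {false} t = inj₂ t

Tnot : ∀ {a} → ¬ T a → T (not a)
Tnot {true} h = h tt
Tnot {false} h = tt

Tnot⁻ : ∀ {a} → T (not a) → ¬ T a
Tnot⁻ {false} _ ()

T⇒≡true : ∀ {a} → T a → a ≡ true
T⇒≡true {true} _ = refl

T-ext : ∀ {a b} → (T a → T b) → (T b → T a) → a ≡ b
T-ext {true} {true} f g = refl
T-ext {true} {false} f g = ⊥-elim (f tt)
T-ext {false} {true} f g = ⊥-elim (g tt)
T-ext {false} {false} f g = refl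

==-refl : ∀ {M} (i : Fin M) → T (i == i)
==-refl i with i ≟ i
... | yes _ = tt
... | no ne = ne refl

==-sound : ∀ {M} {i j : Fin M} → T (i == j) → i ≡ j
==-sound {i = i} {j} t with i ≟ j
... | yes e = e

==-complete : ∀ {M} {i j : Fin M} → i ≡ j → T (i == j)
==-complete refl = ==-refl _

==-sym : ∀ {M} (i j : Fin M) → (i == j) ≡ (j == i)
==-sym i j = T-ext (λ t → ==-complete (sym (==-sound t))) (λ t → ==-complete (sym (==-sound t)))

eqB : Bool → Bool → Bool
eqB a b = not (a xor b)

eqB-sound : ∀ {a b} → T (eqB a b) → a ≡ b
eqB-sound {true} {true} t = refl
eqB-sound {false} {false} t = refl

eqB-refl : ∀ a → T (eqB a a)
eqB-refl true = tt
eqB-refl false = tt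

module _ {A : Set} where

  all-elim : {p : A → Bool} {xs : List A} → T (all p xs) → ∀ {x} → x ∈ xs → T (p x)
  all-elim {p} {y ∷ xs} t (here refl) = proj₁ (T∧⁻ {p y} t)
  all-elim {p} {y ∷ xs} t (there x∈xs) = all-elim {p} {xs} (proj₂ (T∧⁻ {p y} t)) x∈xs

  all-intro : {p : A → Bool} {xs : List A} → (∀ {x} → x ∈ xs → T (p x)) → T (all p xs)
  all-intro {p} {[]} f = tt
  all-intro {p} {y ∷ xs} f = T∧ (f (here refl)) (all-intro {p} {xs} (f ∘ there))

  any-elim : {p : A → Bool} {xs : List A} → T (any p xs) → Σ A λ x → x ∈ xs × T (p x)
  any-elim {p} {y ∷ xs} t with T∨⁻ {p y} t
  ... | inj₁ py = y , here refl , py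
  ... | inj₂ rest = let z , z∈xs , pz = any-elim {p} {xs} rest in z , there z∈xs , pz

  any-intro : {p : A → Bool} {xs : List A} {x : A} → x ∈ xs → T (p x) → T (any p xs)
  any-intro {p} {y ∷ xs} (here refl) t = T∨ˡ (any p xs) t
  any-intro {p} {y ∷ xs} (there x∈xs) t = T∨ʳ (p y) (any-intro {p} {xs} x∈xs t)

  ∈-filterᵇ⁻ : {q : A → Bool} {xs : List A} {x : A} → x ∈ filterᵇ q xs → x ∈ xs × T (q x)
  ∈-filterᵇ⁻ {q} = ∈-filter⁻ (T? ∘ q)

  ∈-filterᵇ⁺ : {q : A → Bool} {xs : List A} {x : A} → x ∈ xs → T (q x) → x ∈ filterᵇ q xs
  ∈-filterᵇ⁺ {q} = ∈-filter⁺ (T? ∘ q)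

allFin-elim : ∀ {M} {p : Fin M → Bool} → T (all p (allFin M)) → ∀ i → T (p i)
allFin-elim {M} t i = all-elim {xs = allFin M} t (∈-allFin i)

allFin-intro : ∀ {M} {p : Fin M → Bool} → (∀ i → T (p i)) → T (all p (allFin M))
allFin-intro {M} h = all-intro {xs = allFin M} (λ {i} _ → h i)

allEq : ∀ {A : Set} {n : ℕ} → (A → A → Bool) → (Fin n → A) → (Fin n → A) → Bool
allEq {n = n} eq g f = all (λ j → eq (g j) (f j)) (allFin n)

allEq-sound : ∀ {A : Set} {n} {eq : A → A → Bool} {g f : Fin n → A} → T (allEq eq g f) → ∀ j → T (eq (g j) (f j))
allEq-sound = allFin-elim

allEq-intro : ∀ {A : Set} {n} {eq : A → A → Bool} {g f : Fin n → A} → (∀ j → T (eq (g j) (f j))) → T (allEq eq g f)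
allEq-intro = allFin-intro

allEq-sym : ∀ {A : Set} {n} (eq : A → A → Bool) → (∀ a b → eq a b ≡ eq b a) → (g f : Fin n → A) → allEq eq g f ≡ allEq eq f g
allEq-sym {n = n} eq eq-sym g f = pointwise (allFin n)
  where
  pointwise : (L : List (Fin n)) → all (λ j → eq (g j) (f j)) L ≡ all (λ j → eq (f j) (g j)) L
  pointwise [] = refl
  pointwise (x ∷ L) = cong₂ _∧_ (eq-sym (g x) (f x)) (pointwise L)

sameSet-sound : ∀ {n} {A B : Subset n} → T (sameSet A B) → ∀ j → A j ≡ B j
sameSet-sound t j = eqB-sound (allFin-elim t j)

sameSet-complete : ∀ {n} {A B : Subset n} → (∀ j → A j ≡ B j) → T (sameSet A B)
sameSet-complete {A = A} h = allFin-intro (λ j → subst (λ z → T (eqB (A j) z)) (h j) (eqB-refl (A j)))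

findMin : ∀ {M} (p : Fin M → Bool) (x : Fin M) → T (p x) → Σ (Fin M) λ i → T (p i) × (∀ y → T (p y) → toℕ i ≤ toℕ y)
findMin {suc M} p x t with p zero in eq
... | true = zero , subst T (sym eq) tt , λ _ _ → z≤n
... | false with x
... | zero = ⊥-elim (subst T eq t)
... | suc x' = let i , ti , h = findMin (p ∘ suc) x' t in
   suc i , ti , λ { zero ty → ⊥-elim (subst T eq ty) ; (suc y) ty → s≤s (h y ty) }

-- Counting.  `count p xs` is the number of entries of xs satisfying p; it is
-- `length (filterᵇ p xs)` but has the more convenient recursive definition.

ι : Bool → ℕ
ι true = 1
ι false = 0

count : ∀ {A : Set} → (A → Bool) → List A → ℕ
count p [] = 0
count p (x ∷ xs) = ι (p x) + count p xs

module _ {A : Set} where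

  length-filterᵇ : (p : A → Bool) (xs : List A) → length (filterᵇ p xs) ≡ count p xs
  length-filterᵇ p [] = refl
  length-filterᵇ p (x ∷ xs) with p x
  ... | true = cong suc (length-filterᵇ p xs)
  ... | false = length-filterᵇ p xs

  count-filterᵇ : (q p : A → Bool) (xs : List A) → count p (filterᵇ q xs) ≡ count (λ x → q x ∧ p x) xs
  count-filterᵇ q p [] = refl
  count-filterᵇ q p (x ∷ xs) with q x
  ... | true = cong (ι (p x) +_) (count-filterᵇ q p xs)
  ... | false = count-filterᵇ q p xs

  count-cong : {p q : A → Bool} (xs : List A) → (∀ {x} → x ∈ xs → p x ≡ q x) → count p xs ≡ count q xs
  count-cong [] f = refl
  count-cong (x ∷ xs) f = cong₂ _+_ (cong ι (f (here refl))) (count-cong xs (f ∘ there))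

  count-zero : {p : A → Bool} (xs : List A) → (∀ {x} → x ∈ xs → ¬ T (p x)) → count p xs ≡ 0
  count-zero {p} [] f = refl
  count-zero {p} (x ∷ xs) f with p x | f (here refl)
  ... | true | h = ⊥-elim (h tt)
  ... | false | _ = count-zero xs (f ∘ there)

  count-++ : (p : A → Bool) (xs ys : List A) → count p (xs ++ ys) ≡ count p xs + count p ys
  count-++ p [] ys = refl
  count-++ p (x ∷ xs) ys = trans (cong (ι (p x) +_) (count-++ p xs ys)) (sym (+-assoc (ι (p x)) _ _))

  count-≤-length : (p : A → Bool) (xs : List A) → count p xs ≤ length xs
  count-≤-length p [] = z≤n
  count-≤-length p (x ∷ xs) with p x
  ... | true = s≤s (count-≤-length p xs)
  ... | false = m≤n⇒m≤1+n (count-≤-length p xs)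

  count-true : (xs : List A) → count (λ _ → true) xs ≡ length xs
  count-true [] = refl
  count-true (x ∷ xs) = cong suc (count-true xs)

  count-not : (p : A → Bool) (xs : List A) → count (not ∘ p) xs ≡ length xs ∸ count p xs
  count-not p [] = refl
  count-not p (x ∷ xs) with p x
  ... | true = count-not p xs
  ... | false = trans (cong suc (count-not p xs)) (sym (+-∸-assoc 1 (count-≤-length p xs)))

  count-split : (p q : A → Bool) (xs : List A) → count p xs ≡ count (λ x → p x ∧ q x) xs + count (λ x → p x ∧ not (q x)) xs
  count-split p q [] = refl
  count-split p q (x ∷ xs) with p x | q x
  ... | true | true = cong suc (count-split p q xs)
  ... | true | false = trans (cong suc (count-split p q xs)) (sym (+-suc _ _))
  ... | false | _ = count-split p q xs

  count-∨ : (p q : A → Bool) (xs : List A) → (∀ {x} → x ∈ xs → T (p x) → T (q x) → ⊥) →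
            count (λ x → p x ∨ q x) xs ≡ count p xs + count q xs
  count-∨ p q [] f = refl
  count-∨ p q (x ∷ xs) f with p x | q x | f (here refl)
  ... | true | true | h = ⊥-elim (h tt tt)
  ... | true | false | _ = cong suc (count-∨ p q xs (f ∘ there))
  ... | false | true | _ = trans (cong suc (count-∨ p q xs (f ∘ there))) (sym (+-suc _ _))
  ... | false | false | _ = count-∨ p q xs (f ∘ there)

  count-∧-const : (p : A → Bool) (c : Bool) (xs : List A) → count (λ a → p a ∧ c) xs ≡ (if c then count p xs else 0)
  count-∧-const p true xs = count-cong xs (λ {a} _ → ∧-identityʳ (p a))
  count-∧-const p false xs = count-zero xs (λ {a} _ → subst T (∧-zeroʳ (p a)))

  sum-map-cong : {f g : A → ℕ} (xs : List A) → (∀ {x} → x ∈ xs → f x ≡ g x) → sum (map f xs) ≡ sum (map g xs)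
  sum-map-cong [] h = refl
  sum-map-cong (x ∷ xs) h = cong₂ _+_ (h (here refl)) (sum-map-cong xs (h ∘ there))

  sum-map-ι : (p : A → Bool) (xs : List A) → sum (map (λ x → ι (p x)) xs) ≡ count p xs
  sum-map-ι p [] = refl
  sum-map-ι p (x ∷ xs) = cong (ι (p x) +_) (sum-map-ι p xs)

  sum-map-const : (c : ℕ) (xs : List A) → sum (map (λ _ → c) xs) ≡ length xs * c
  sum-map-const c [] = refl
  sum-map-const c (x ∷ xs) = cong (c +_) (sum-map-const c xs)

  sum-map-filterᵇ : (q : A → Bool) (f : A → ℕ) (xs : List A) →
    sum (map f (filterᵇ q xs)) ≡ sum (map (λ x → if q x then f x else 0) xs)
  sum-map-filterᵇ q f [] = refl
  sum-map-filterᵇ q f (x ∷ xs) with q x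
  ... | true = cong (f x +_) (sum-map-filterᵇ q f xs)
  ... | false = sum-map-filterᵇ q f xs

module _ {A B : Set} where

  count-map : (p : B → Bool) (h : A → B) (xs : List A) → count p (map h xs) ≡ count (p ∘ h) xs
  count-map p h [] = refl
  count-map p h (x ∷ xs) = cong (ι (p (h x)) +_) (count-map p h xs)

  count-concatMap : (p : B → Bool) (h : A → List B) (xs : List A) →
                    count p (concatMap h xs) ≡ sum (map (λ x → count p (h x)) xs)
  count-concatMap p h [] = refl
  count-concatMap p h (x ∷ xs) = trans (count-++ p (h x) (concat (map h xs))) (cong (count p (h x) +_) (count-concatMap p h xs))

  length-concatMap : (h : A → List B) (xs : List A) → length (concatMap h xs) ≡ sum (map (λ x → length (h x)) xs)
  length-concatMap h xs = begin
    length (concatMap h xs)                         ≡⟨ sym (count-true (concatMap h xs)) ⟩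
    count (λ _ → true) (concatMap h xs)             ≡⟨ count-concatMap (λ _ → true) h xs ⟩
    sum (map (λ x → count (λ _ → true) (h x)) xs)   ≡⟨ sum-map-cong xs (λ {x} _ → count-true (h x)) ⟩
    sum (map (λ x → length (h x)) xs)               ∎
    where open ≡-Reasoning

  swap-sum : (R : A → B → Bool) (xs : List A) (ys : List B) →
    sum (map (λ x → count (R x) ys) xs) ≡ sum (map (λ y → count (λ x → R x y) xs) ys)
  swap-sum R [] ys = sym (trans (sum-map-const 0 ys) (*-zeroʳ (length ys)))
  swap-sum R (x ∷ xs) ys = trans (cong (count (R x) ys +_) (swap-sum R xs ys)) (add-row ys)
    where
    column : B → ℕ
    column y = count (λ x' → R x' y) xs
    add-row : (zs : List B) → count (R x) zs + sum (map column zs) ≡ sum (map (λ y → count (λ x' → R x' y) (x ∷ xs)) zs)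
    add-row [] = refl
    add-row (z ∷ zs) = trans (interchange (ι (R x z)) (count (R x) zs) (column z) (sum (map column zs)))
                             (cong ((ι (R x z) + column z) +_) (add-row zs))

exact-length : ∀ {A : Set} (eq : A → A → Bool) → (∀ a b → eq a b ≡ eq b a) → (xs ys : List A) →
  (∀ {x} → x ∈ xs → count (eq x) ys ≡ 1) → (∀ {y} → y ∈ ys → count (eq y) xs ≡ 1) →
  length xs ≡ length ys
exact-length eq eq-sym xs ys matchˣ matchʸ = begin
  length xs                                    ≡⟨ sym (trans (sum-map-const 1 xs) (*-identityʳ _)) ⟩
  sum (map (λ _ → 1) xs)                       ≡⟨ sum-map-cong xs (sym ∘ matchˣ) ⟩
  sum (map (λ x → count (eq x) ys) xs)         ≡⟨ swap-sum eq xs ys ⟩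
  sum (map (λ y → count (λ x → eq x y) xs) ys) ≡⟨ sum-map-cong ys (λ {y} y∈ys → trans (count-cong xs (λ {x} _ → eq-sym x y)) (matchʸ y∈ys)) ⟩
  sum (map (λ _ → 1) ys)                       ≡⟨ trans (sum-map-const 1 ys) (*-identityʳ _) ⟩
  length ys                                    ∎
  where open ≡-Reasoning

-- Counting over Fin M.  `allFin (suc M)` unfolds to `zero ∷ tabulate suc`.

count-tabulate-suc : ∀ M (p : Fin (suc M) → Bool) → count p (tabulate {n = M} suc) ≡ count (p ∘ suc) (allFin M)
count-tabulate-suc M p = trans (cong (count p) (sym (map-tabulate (λ i → i) suc))) (count-map p suc (allFin M))

all-tabulate-suc : ∀ M (p : Fin (suc M) → Bool) → all p (tabulate {n = M} suc) ≡ all (p ∘ suc) (allFin M)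
all-tabulate-suc M p = trans (cong (all p) (sym (map-tabulate (λ i → i) suc))) (all-map (allFin M))
  where
  all-map : (L : List (Fin M)) → all p (map suc L) ≡ all (p ∘ suc) L
  all-map [] = refl
  all-map (x ∷ L) = cong (p (suc x) ∧_) (all-map L)

count-allFin-≤1 : ∀ M (p : Fin M → Bool) → (∀ x y → T (p x) → T (p y) → x ≡ y) → count p (allFin M) ≤ 1
count-allFin-≤1 zero p unique = z≤n
count-allFin-≤1 (suc M) p unique with p zero in eq
... | true = ≤-reflexive (cong suc (trans (count-tabulate-suc M p) (count-zero (allFin M) no-other)))
  where
  no-other : ∀ {x} → x ∈ allFin M → ¬ T (p (suc x))
  no-other {x} _ t = 0≢1+n (cong toℕ (unique zero (suc x) (subst T (sym eq) tt) t))
... | false = subst (_≤ 1) (sym (count-tabulate-suc M p))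
                (count-allFin-≤1 M (p ∘ suc) (λ x y px py → fsuc-injective (unique (suc x) (suc y) px py)))

count-allFin-≥1 : ∀ M (p : Fin M → Bool) (x : Fin M) → T (p x) → 1 ≤ count p (allFin M)
count-allFin-≥1 M p x px = go (allFin M) (∈-allFin x)
  where
  go : (xs : List (Fin M)) → x ∈ xs → 1 ≤ count p xs
  go (y ∷ xs) (here refl) with p y
  ... | true = s≤s z≤n
  go (y ∷ xs) (there x∈xs) = ≤-trans (go xs x∈xs) (m≤n+m _ (ι (p y)))

count-allFin-1 : ∀ M (p : Fin M → Bool) (x : Fin M) → T (p x) → (∀ x y → T (p x) → T (p y) → x ≡ y) → count p (allFin M) ≡ 1
count-allFin-1 M p x px unique = ≤-antisym (count-allFin-≤1 M p unique) (count-allFin-≥1 M p x px)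

count-allFin-≥2 : ∀ M (p : Fin M → Bool) x y → T (p x) → T (p y) → x ≢ y → 2 ≤ count p (allFin M)
count-allFin-≥2 M p x y px py x≢y = subst (2 ≤_) (sym (count-split p (_== x) (allFin M)))
  (+-mono-≤ (count-allFin-≥1 M _ x (T∧ px (==-refl x)))
            (count-allFin-≥1 M _ y (T∧ py (Tnot (λ e → x≢y (sym (==-sound e)))))))

count-allFin-== : ∀ M (v : Fin M) → count (_== v) (allFin M) ≡ 1
count-allFin-== M v = count-allFin-1 M _ v (==-refl v) (λ x y x=v y=v → trans (==-sound x=v) (sym (==-sound y=v)))

allFunsFrom-exact : ∀ {A : Set} (eq : A → A → Bool) (xs : List A) (n : ℕ) (f : Fin n → A) →
  (∀ j → count (λ a → eq a (f j)) xs ≡ 1) →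
  count (λ h → allEq eq h f) (allFunsFrom xs n) ≡ 1
allFunsFrom-exact eq xs zero f once = refl
allFunsFrom-exact {A} eq xs (suc n) f once = begin
  count (λ h → allEq eq h f) (allFunsFrom xs (suc n))
    ≡⟨ count-concatMap (λ h → allEq eq h f) _ (allFunsFrom xs n) ⟩
  _ ≡⟨ sum-map-cong (allFunsFrom xs n) (λ {h} _ → extensions h _ (λ a → cong (eq a (f zero) ∧_) (all-tabulate-suc n _))) ⟩
  sum (map (λ h → ι (allEq eq h (f ∘ suc))) (allFunsFrom xs n))
    ≡⟨ sum-map-ι (λ h → allEq eq h (f ∘ suc)) (allFunsFrom xs n) ⟩
  count (λ h → allEq eq h (f ∘ suc)) (allFunsFrom xs n)
    ≡⟨ allFunsFrom-exact eq xs n (f ∘ suc) (once ∘ suc) ⟩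
  1 ∎
  where
  open ≡-Reasoning
  by-head : (c : Bool) → (if c then count (λ a → eq a (f zero)) xs else 0) ≡ ι c
  by-head true = once zero
  by-head false = refl
  extensions : ∀ h (ext : A → Fin (suc n) → A) →
    (∀ a → allEq eq (ext a) f ≡ (eq a (f zero) ∧ allEq eq h (f ∘ suc))) →
    count (λ h' → allEq eq h' f) (map ext xs) ≡ ι (allEq eq h (f ∘ suc))
  extensions h ext agree = begin
    count (λ h' → allEq eq h' f) (map ext xs)
      ≡⟨ count-map (λ h' → allEq eq h' f) ext xs ⟩
    count (λ a → allEq eq (ext a) f) xs
      ≡⟨ count-cong xs (λ {a} _ → agree a) ⟩
    count (λ a → eq a (f zero) ∧ allEq eq h (f ∘ suc)) xs
      ≡⟨ count-∧-const (λ a → eq a (f zero)) (allEq eq h (f ∘ suc)) xs ⟩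
    (if allEq eq h (f ∘ suc) then count (λ a → eq a (f zero)) xs else 0)
      ≡⟨ by-head (allEq eq h (f ∘ suc)) ⟩
    ι (allEq eq h (f ∘ suc)) ∎

module _ {A : Set} (h : A → A) where

  iter-+ : ∀ a b x → (h ^[ a + b ]) x ≡ (h ^[ a ]) ((h ^[ b ]) x)
  iter-+ zero b x = refl
  iter-+ (suc a) b x = cong h (iter-+ a b x)

  iter-injective : (∀ {x y} → h x ≡ h y → x ≡ y) → ∀ s {x y} → (h ^[ s ]) x ≡ (h ^[ s ]) y → x ≡ y
  iter-injective h-inj zero e = e
  iter-injective h-inj (suc s) e = iter-injective h-inj s (h-inj e)

  iter-comm : ∀ s x → h ((h ^[ s ]) x) ≡ (h ^[ s ]) (h x)
  iter-comm zero x = refl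
  iter-comm (suc s) x = cong h (iter-comm s x)

  iter-* : ∀ d s x → ((h ^[ d ]) ^[ s ]) x ≡ (h ^[ s * d ]) x
  iter-* d zero x = refl
  iter-* d (suc s) x = trans (cong (h ^[ d ]) (iter-* d s x)) (sym (iter-+ d (s * d) x))

-- (m - 1) s + s = s m, used to invert a step of length s in a cycle of length m.
[m∸1]*s+s≡s*m : ∀ m s → 1 ≤ m → (m ∸ 1) * s + s ≡ s * m
[m∸1]*s+s≡s*m m s 1≤m = begin
  (m ∸ 1) * s + s     ≡⟨ cong ((m ∸ 1) * s +_) (sym (*-identityˡ s)) ⟩
  (m ∸ 1) * s + 1 * s ≡⟨ sym (*-distribʳ-+ s (m ∸ 1) 1) ⟩
  (m ∸ 1 + 1) * s     ≡⟨ cong (_* s) (m∸n+n≡m 1≤m) ⟩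
  m * s               ≡⟨ *-comm m s ⟩
  s * m               ∎
  where open ≡-Reasoning

cyc-toℕ : ∀ {N} .{{_ : NonZero N}} (i : Fin N) → toℕ (cyc i) ≡ suc (toℕ i) % N
cyc-toℕ {suc N} i = toℕ-fromℕ< _

module Shift (N : ℕ) {{_ : NonZero N}} where

  V : Set
  V = Fin (suc N)

  infixl 6 _+ₘ_
  _+ₘ_ : Fin N → ℕ → Fin N
  x +ₘ t = fromℕ< (m%n<n (toℕ x + t) N)

  g^-zero : ∀ t → (g ^[ t ]) (zero {n = N}) ≡ zero
  g^-zero zero = refl
  g^-zero (suc t) rewrite g^-zero t = refl

  g^-suc : ∀ t (x : Fin N) → (g ^[ t ]) (suc x) ≡ suc (x +ₘ t)
  g^-suc zero x = cong suc (toℕ-injective (sym (begin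
    toℕ (x +ₘ 0)       ≡⟨ toℕ-fromℕ< _ ⟩
    (toℕ x + 0) % N    ≡⟨ cong (_% N) (+-identityʳ (toℕ x)) ⟩
    toℕ x % N          ≡⟨ m<n⇒m%n≡m (toℕ<n x) ⟩
    toℕ x              ∎)))
    where open ≡-Reasoning
  g^-suc (suc t) x rewrite g^-suc t x = cong suc (toℕ-injective (begin
    toℕ (cyc (x +ₘ t))                   ≡⟨ cyc-toℕ (x +ₘ t) ⟩
    suc (toℕ (x +ₘ t)) % N               ≡⟨ cong (λ z → suc z % N) (toℕ-fromℕ< _) ⟩
    (1 + (toℕ x + t) % N) % N            ≡⟨ %-distribˡ-+ 1 ((toℕ x + t) % N) N ⟩
    (1 % N + (toℕ x + t) % N % N) % N    ≡⟨ cong (λ z → (1 % N + z) % N) (m%n%n≡m%n (toℕ x + t) N) ⟩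
    (1 % N + (toℕ x + t) % N) % N        ≡⟨ sym (%-distribˡ-+ 1 (toℕ x + t) N) ⟩
    (1 + (toℕ x + t)) % N                ≡⟨ cong (_% N) (sym (+-suc (toℕ x) t)) ⟩
    (toℕ x + suc t) % N                  ≡⟨ sym (toℕ-fromℕ< _) ⟩
    toℕ (x +ₘ suc t)                     ∎))
    where open ≡-Reasoning

  g^-period : ∀ t → N ∣ t → ∀ (y : V) → (g ^[ t ]) y ≡ y
  g^-period t _ zero = g^-zero t
  g^-period t (divides q refl) (suc x) = trans (g^-suc (q * N) x) (cong suc (toℕ-injective (begin
    toℕ (x +ₘ q * N)         ≡⟨ toℕ-fromℕ< _ ⟩
    (toℕ x + q * N) % N      ≡⟨ [m+kn]%n≡m%n (toℕ x) q N ⟩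
    toℕ x % N                ≡⟨ m<n⇒m%n≡m (toℕ<n x) ⟩
    toℕ x                    ∎)))
    where open ≡-Reasoning

  g^-stabiliser : ∀ t (x : Fin N) → (g ^[ t ]) (suc x) ≡ suc x → N ∣ t
  g^-stabiliser t x e = divides ((toℕ x + t) / N) (+-cancelˡ-≡ (toℕ x) t _ (begin
    toℕ x + t                                  ≡⟨ m≡m%n+[m/n]*n (toℕ x + t) N ⟩
    (toℕ x + t) % N + (toℕ x + t) / N * N      ≡⟨ cong (_+ (toℕ x + t) / N * N) remainder ⟩
    toℕ x + (toℕ x + t) / N * N                ∎))
    where
    open ≡-Reasoning
    remainder : (toℕ x + t) % N ≡ toℕ x
    remainder = trans (sym (toℕ-fromℕ< (m%n<n (toℕ x + t) N))) (cong toℕ (fsuc-injective (trans (sym (g^-suc t x)) e)))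

  g-injective : ∀ {x y : V} → g x ≡ g y → x ≡ y
  g-injective {x} {y} e = trans (sym (undo x)) (trans (cong (g ^[ N ∸ 1 ]) e) (undo y))
    where
    undo : ∀ z → (g ^[ N ∸ 1 ]) (g z) ≡ z
    undo z = trans (sym (iter-+ g (N ∸ 1) 1 z)) (trans (cong (λ u → (g ^[ u ]) z) (m∸n+n≡m {N} {1} (>-nonZero⁻¹ N))) (g^-period N ∣-refl z))

  g^-nonzero : ∀ t (x : Fin N) → (g ^[ t ]) (suc x) ≢ zero
  g^-nonzero t x e with trans (sym (g^-suc t x)) e
  ... | ()

module Power (N : ℕ) {{_ : NonZero N}} (d m : ℕ) (d>0 : 0 < d) (d<N : d < N) (m-def : m * gcd N d ≡ N) where
  open Shift N public

  G : V → V
  G = g ^[ d ]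

  private
    c : ℕ
    c = gcd N d

    instance
      c-nonZero : NonZero c
      c-nonZero = ≢-nonZero (λ c≡0 → <⇒≢ d>0 (sym (gcd[m,n]≡0⇒n≡0 N c≡0)))

    d' : ℕ
    d' = quotient (gcd[m,n]∣n N d)

    d≡d'*c : d ≡ d' * c
    d≡d'*c = _∣_.equality (gcd[m,n]∣n N d)

    m⊥d' : Coprime m d'
    m⊥d' = GCD≡1⇒coprime (GCD-* {c = c} (subst₂ (λ a b → GCD a b (1 * c)) (sym m-def) d≡d'*c
                                            (subst (GCD N d) (sym (+-identityʳ c)) (gcd-GCD N d))))

  N∣s*d⇒m∣s : ∀ s → N ∣ s * d → m ∣ s
  N∣s*d⇒m∣s s N∣s*d = coprime-divisor m⊥d' (*-cancelʳ-∣ c (subst₂ _∣_ (sym m-def) s*d≡d'*s*c N∣s*d))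
    where
    s*d≡d'*s*c : s * d ≡ d' * s * c
    s*d≡d'*s*c = trans (cong (s *_) d≡d'*c) (trans (sym (*-assoc s d' c)) (cong (_* c) (*-comm s d')))

  m∣s⇒N∣s*d : ∀ s → m ∣ s → N ∣ s * d
  m∣s⇒N∣s*d s (divides q refl) = divides (q * d') (begin
      q * m * d         ≡⟨ cong (q * m *_) d≡d'*c ⟩
      q * m * (d' * c)  ≡⟨ *-assoc q m (d' * c) ⟩
      q * (m * (d' * c)) ≡⟨ cong (q *_) (x∙yz≈y∙xz m d' c) ⟩
      q * (d' * (m * c)) ≡⟨ sym (*-assoc q d' (m * c)) ⟩
      q * d' * (m * c)  ≡⟨ cong (q * d' *_) m-def ⟩
      q * d' * N        ∎)
    where open ≡-Reasoning

  G^≡g^ : ∀ s y → (G ^[ s ]) y ≡ (g ^[ s * d ]) y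
  G^≡g^ s y = iter-* g d s y

  G^-period : ∀ s → m ∣ s → ∀ y → (G ^[ s ]) y ≡ y
  G^-period s m∣s y = trans (G^≡g^ s y) (g^-period (s * d) (m∣s⇒N∣s*d s m∣s) y)

  G^-stabiliser : ∀ s (y : V) → y ≢ zero → (G ^[ s ]) y ≡ y → m ∣ s
  G^-stabiliser s zero y≢0 _ = ⊥-elim (y≢0 refl)
  G^-stabiliser s (suc x) _ e = N∣s*d⇒m∣s s (g^-stabiliser (s * d) x (trans (sym (G^≡g^ s (suc x))) e))

  G^-injective : ∀ s {x y} → (G ^[ s ]) x ≡ (G ^[ s ]) y → x ≡ y
  G^-injective = iter-injective G (iter-injective g g-injective d)

  G^-zero : ∀ s → (G ^[ s ]) zero ≡ zero
  G^-zero s = trans (G^≡g^ s zero) (g^-zero (s * d))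

  G^-nonzero : ∀ s (y : V) → y ≢ zero → (G ^[ s ]) y ≢ zero
  G^-nonzero s zero y≢0 = ⊥-elim (y≢0 refl)
  G^-nonzero s (suc x) _ e = g^-nonzero (s * d) x (trans (sym (G^≡g^ s (suc x))) e)

  m≢0 : m ≢ 0
  m≢0 m≡0 = ≢-nonZero⁻¹ N (trans (sym m-def) (cong (_* c) m≡0))

  instance
    m-nonZero : NonZero m
    m-nonZero = ≢-nonZero m≢0

  m≢1 : m ≢ 1
  m≢1 m≡1 = <⇒≱ d<N (∣⇒≤ {{>-nonZero d>0}} N∣d)
    where
    N∣d : N ∣ d
    N∣d = subst (_∣ d) (trans (sym (*-identityˡ c)) (trans (cong (_* c) (sym m≡1)) m-def)) (gcd[m,n]∣n N d)

  1<m : 1 < m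
  1<m = ≤∧≢⇒< (n≢0⇒n>0 m≢0) (m≢1 ∘ sym)

  0<m : 0 < m
  0<m = <-trans (s≤s z≤n) 1<m

  G^-mod : ∀ s y → (G ^[ s ]) y ≡ (G ^[ s % m ]) y
  G^-mod s y = begin
    (G ^[ s ]) y                                  ≡⟨ cong (λ u → (G ^[ u ]) y) (m≡m%n+[m/n]*n s m) ⟩
    (G ^[ s % m + s / m * m ]) y                  ≡⟨ iter-+ G (s % m) (s / m * m) y ⟩
    (G ^[ s % m ]) ((G ^[ s / m * m ]) y)         ≡⟨ cong (G ^[ s % m ]) (G^-period (s / m * m) (n∣m*n (s / m)) y) ⟩
    (G ^[ s % m ]) y                              ∎
    where open ≡-Reasoning

  private
    G^-distinct-≤ : ∀ {s t} (y : V) → y ≢ zero → s ≤ t → t < m → (G ^[ s ]) y ≡ (G ^[ t ]) y → s ≡ t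
    G^-distinct-≤ {s} {t} y y≢0 s≤t t<m e = sym (trans (sym (m+[n∸m]≡n s≤t)) (trans (cong (s +_) t∸s≡0) (+-identityʳ s)))
      where
      fixed : (G ^[ t ∸ s ]) y ≡ y
      fixed = sym (G^-injective s (trans e (trans (cong (λ z → (G ^[ z ]) y) (sym (m+[n∸m]≡n s≤t))) (iter-+ G s (t ∸ s) y))))
      t∸s≡0 : t ∸ s ≡ 0
      t∸s≡0 with t ∸ s | G^-stabiliser (t ∸ s) y y≢0 fixed | m∸n≤m t s
      ... | zero | _ | _ = refl
      ... | suc u | m∣ | u<t = ⊥-elim (<⇒≱ (≤-<-trans u<t t<m) (∣⇒≤ m∣))

  G^-distinct : ∀ {s t} (y : V) → y ≢ zero → s < m → t < m → (G ^[ s ]) y ≡ (G ^[ t ]) y → s ≡ t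
  G^-distinct {s} {t} y y≢0 s<m t<m e with ≤-total s t
  ... | inj₁ s≤t = G^-distinct-≤ y y≢0 s≤t t<m e
  ... | inj₂ t≤s = sym (G^-distinct-≤ y y≢0 t≤s s<m (sym e))

fallingProd-suc : ∀ N m r → fallingProd N m (suc r) ≡ fallingProd N m r * (N ∸ r * m)
fallingProd-suc N m r = begin
  product (map factor (upTo (suc r)))               ≡⟨ cong (product ∘ map factor) (sym (applyUpTo-∷ʳ (λ j → j) r)) ⟩
  product (map factor (upTo r ++ r ∷ []))           ≡⟨ cong product (map-++ factor (upTo r) (r ∷ [])) ⟩
  product (map factor (upTo r) ++ factor r ∷ [])    ≡⟨ product-++ (map factor (upTo r)) (factor r ∷ []) ⟩
  fallingProd N m r * (factor r * 1)                ≡⟨ cong (fallingProd N m r *_) (*-identityʳ _) ⟩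
  fallingProd N m r * factor r                      ∎
  where
  open ≡-Reasoning
  factor : ℕ → ℕ
  factor j = N ∸ j * m

module Transversals (N : ℕ) {{_ : NonZero N}} (d m : ℕ) (d>0 : 0 < d) (d<N : d < N) (m-def : m * gcd N d ≡ N) where
  open Power N d m d>0 d<N m-def public

  Orb : V → V → Set
  Orb x y = Σ ℕ λ s → y ≡ (G ^[ s ]) x

  Orb-sym : ∀ {x y} → Orb x y → Orb y x
  Orb-sym {x} (s , refl) = (m ∸ 1) * s , sym (begin
    (G ^[ (m ∸ 1) * s ]) ((G ^[ s ]) x) ≡⟨ sym (iter-+ G ((m ∸ 1) * s) s x) ⟩
    (G ^[ (m ∸ 1) * s + s ]) x          ≡⟨ G^-period _ (divides s ([m∸1]*s+s≡s*m m s 0<m)) x ⟩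
    x                                   ∎)
    where open ≡-Reasoning

  Orb-trans : ∀ {x y z} → Orb x y → Orb y z → Orb x z
  Orb-trans {x} (s , refl) (t , refl) = t + s , sym (iter-+ G t s x)

  inOrbitᵇ : ℕ → V → V → Bool
  inOrbitᵇ zero x y = false
  inOrbitᵇ (suc t) x y = (y == (G ^[ t ]) x) ∨ inOrbitᵇ t x y

  inOrbitᵇ-sound : ∀ t {x y} → T (inOrbitᵇ t x y) → Σ ℕ λ s → s < t × y ≡ (G ^[ s ]) x
  inOrbitᵇ-sound (suc t) {x} {y} h with T∨⁻ {y == (G ^[ t ]) x} h
  ... | inj₁ e = t , ≤-refl , ==-sound e
  ... | inj₂ r = let s , s<t , e = inOrbitᵇ-sound t r in s , m≤n⇒m≤1+n s<t , e

  inOrbitᵇ-complete : ∀ t {x y} s → s < t → y ≡ (G ^[ s ]) x → T (inOrbitᵇ t x y)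
  inOrbitᵇ-complete (suc t) {x} {y} s s<t e with s ≟ℕ t
  ... | yes refl = T∨ˡ (inOrbitᵇ t x y) (==-complete e)
  ... | no s≢t = T∨ʳ (y == (G ^[ t ]) x) (inOrbitᵇ-complete t s (≤∧≢⇒< (≤-pred s<t) s≢t) e)

  orbitᵇ : V → V → Bool
  orbitᵇ = inOrbitᵇ m

  orbitᵇ-sound : ∀ {x y} → T (orbitᵇ x y) → Orb x y
  orbitᵇ-sound h = let s , _ , e = inOrbitᵇ-sound m h in s , e

  orbitᵇ-complete : ∀ {x y} → Orb x y → T (orbitᵇ x y)
  orbitᵇ-complete (s , e) = inOrbitᵇ-complete m (s % m) (m%n<n s m) (trans e (G^-mod s _))

  orbit-size : ∀ x → x ≢ zero → count (orbitᵇ x) (allFin (suc N)) ≡ m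
  orbit-size x x≢0 = initial-segment m ≤-refl
    where
    initial-segment : ∀ t → t ≤ m → count (inOrbitᵇ t x) (allFin (suc N)) ≡ t
    initial-segment zero _ = count-zero {p = λ _ → false} (allFin (suc N)) (λ _ ())
    initial-segment (suc t) t<m = trans (count-∨ (_== (G ^[ t ]) x) (inOrbitᵇ t x) (allFin (suc N)) new-point)
      (cong₂ _+_ (count-allFin-== (suc N) ((G ^[ t ]) x)) (initial-segment t (≤-trans (n≤1+n t) t<m)))
      where
      new-point : ∀ {y} → y ∈ allFin (suc N) → T (y == (G ^[ t ]) x) → T (inOrbitᵇ t x y) → ⊥
      new-point _ y=Gᵗx earlier = let s , s<t , e = inOrbitᵇ-sound t earlier in
        <-irrefl refl (subst (_< t) (G^-distinct x x≢0 (<-trans s<t t<m) t<m (trans (sym e) (==-sound y=Gᵗx))) s<t)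

  module _ {I : Set} where

    Fresh : List (I × V) → V → Set
    Fresh Z y = y ≢ zero × (∀ {p} → p ∈ Z → ¬ Orb (proj₂ p) y)

    freshᵇ : List (I × V) → V → Bool
    freshᵇ Z y = not (y == zero) ∧ all (λ p → not (orbitᵇ (proj₂ p) y)) Z

    fresh-sound : ∀ {Z y} → T (freshᵇ Z y) → Fresh Z y
    fresh-sound {Z} {y} h = let y≠0 , outside = T∧⁻ {not (y == zero)} h in
      (λ e → Tnot⁻ y≠0 (==-complete e)) , λ p∈Z o → Tnot⁻ (all-elim {xs = Z} outside p∈Z) (orbitᵇ-complete o)

    fresh-complete : ∀ {Z y} → Fresh Z y → T (freshᵇ Z y)
    fresh-complete {Z} (y≢0 , outside) =
      T∧ (Tnot (y≢0 ∘ ==-sound)) (all-intro {xs = Z} (λ p∈Z → Tnot (outside p∈Z ∘ orbitᵇ-sound)))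

    Fresh-orbit : ∀ {Z x y} → Fresh Z x → Orb x y → Fresh Z y
    Fresh-orbit {x = x} (x≢0 , outside) (s , refl) = G^-nonzero s x x≢0 , λ p∈Z o → outside p∈Z (Orb-trans o (Orb-sym (s , refl)))

    Transversal : List (I × V) → Set
    Transversal [] = ⊤
    Transversal ((i , y) ∷ Z) = Fresh Z y × Transversal Z

    transversal-nonzero : (Z : List (I × V)) → Transversal Z → ∀ {i x} → (i , x) ∈ Z → x ≢ zero
    transversal-nonzero ((i₀ , x₀) ∷ Z) ((x₀≢0 , _) , _) (here refl) = x₀≢0
    transversal-nonzero ((i₀ , x₀) ∷ Z) (_ , tZ) (there mem) = transversal-nonzero Z tZ mem

    transversal-distinct : (Z : List (I × V)) → Transversal Z → ∀ {i x i' x'} → (i , x) ∈ Z → (i' , x') ∈ Z → i ≢ i' → ¬ Orb x x'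
    transversal-distinct ((i₀ , x₀) ∷ Z) _ (here refl) (here refl) i≢i' = ⊥-elim (i≢i' refl)
    transversal-distinct ((i₀ , x₀) ∷ Z) ((_ , outside) , _) (here refl) (there mem') _ o = outside mem' (Orb-sym o)
    transversal-distinct ((i₀ , x₀) ∷ Z) ((_ , outside) , _) (there mem) (here refl) _ o = outside mem o
    transversal-distinct ((i₀ , x₀) ∷ Z) (_ , tZ) (there mem) (there mem') i≢i' o = transversal-distinct Z tZ mem mem' i≢i' o

    transversals : List I → List (List (I × V))
    transversals [] = [] ∷ []
    transversals (i ∷ is) = concatMap (λ Z → map (λ y → (i , y) ∷ Z) (filterᵇ (freshᵇ Z) (allFin (suc N)))) (transversals is)

    transversals-sound : ∀ is {Z} → Z ∈ transversals is → map proj₁ Z ≡ is × Transversal Z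
    transversals-sound [] (here refl) = refl , tt
    transversals-sound (i ∷ is) Z∈ with ∈-concat⁻′ (map _ (transversals is)) Z∈
    ... | L , Z∈L , L∈ with ∈-map⁻ _ L∈
    ... | Z' , Z'∈ , refl with ∈-map⁻ _ Z∈L
    ... | y , y∈ , refl = let indices , tZ' = transversals-sound is Z'∈ in
      cong (i ∷_) indices , fresh-sound (proj₂ (∈-filterᵇ⁻ {q = freshᵇ Z'} {xs = allFin (suc N)} y∈)) , tZ'

    -- Each orbit already used removes m candidates for the next value.
    count-fresh : ∀ Z → Transversal Z → count (freshᵇ Z) (allFin (suc N)) ≡ N ∸ length Z * m
    count-fresh [] tt = begin
      count (freshᵇ []) A                          ≡⟨ count-cong A (λ {y} _ → ∧-identityʳ (not (y == zero))) ⟩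
      count (not ∘ (_== zero)) A                   ≡⟨ count-not (_== zero) A ⟩
      length A ∸ count (_== zero) A                ≡⟨ cong₂ _∸_ (length-tabulate {n = suc N} (λ i → i)) (count-allFin-== (suc N) zero) ⟩
      N ∸ 0                                        ∎
      where
      open ≡-Reasoning
      A = allFin (suc N)
    count-fresh ((i , x) ∷ Z) (x-fresh , tZ) = begin
      count (freshᵇ ((i , x) ∷ Z)) A           ≡⟨ count-cong A (λ {y} _ → rearrange (not (y == zero)) (not (orbitᵇ x y)) _) ⟩
      count (λ y → freshᵇ Z y ∧ not (orbitᵇ x y)) A
        ≡⟨ sym (m+n∸m≡n (count (λ y → freshᵇ Z y ∧ orbitᵇ x y) A) _) ⟩
      (count (λ y → freshᵇ Z y ∧ orbitᵇ x y) A + count (λ y → freshᵇ Z y ∧ not (orbitᵇ x y)) A) ∸ count (λ y → freshᵇ Z y ∧ orbitᵇ x y) A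
        ≡⟨ cong₂ _∸_ (sym (count-split (freshᵇ Z) (orbitᵇ x) A)) (trans (count-cong A orbit-is-fresh) (orbit-size x (proj₁ x-fresh))) ⟩
      count (freshᵇ Z) A ∸ m                  ≡⟨ cong (_∸ m) (count-fresh Z tZ) ⟩
      N ∸ length Z * m ∸ m                    ≡⟨ ∸-+-assoc N (length Z * m) m ⟩
      N ∸ (length Z * m + m)                  ≡⟨ cong (N ∸_) (+-comm (length Z * m) m) ⟩
      N ∸ suc (length Z) * m                  ∎
      where
      open ≡-Reasoning
      A = allFin (suc N)
      rearrange : ∀ a b c → (a ∧ (b ∧ c)) ≡ ((a ∧ c) ∧ b)
      rearrange true true c = sym (∧-identityʳ c)
      rearrange true false c = sym (∧-zeroʳ c)
      rearrange false b c = refl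
      orbit-is-fresh : ∀ {y} → y ∈ A → (freshᵇ Z y ∧ orbitᵇ x y) ≡ orbitᵇ x y
      orbit-is-fresh {y} _ with orbitᵇ x y in eq
      ... | false = ∧-zeroʳ (freshᵇ Z y)
      ... | true = trans (∧-identityʳ (freshᵇ Z y)) (T⇒≡true (fresh-complete (Fresh-orbit x-fresh (orbitᵇ-sound (subst T (sym eq) tt)))))

    length-transversals : ∀ is → length (transversals is) ≡ fallingProd N m (length is)
    length-transversals [] = refl
    length-transversals (i ∷ is) = begin
      length (transversals (i ∷ is))
        ≡⟨ length-concatMap _ (transversals is) ⟩
      sum (map (λ Z → length (map (λ y → (i , y) ∷ Z) (filterᵇ (freshᵇ Z) (allFin (suc N))))) (transversals is))
        ≡⟨ sum-map-cong (transversals is) choices ⟩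
      sum (map (λ _ → N ∸ length is * m) (transversals is))
        ≡⟨ sum-map-const _ (transversals is) ⟩
      length (transversals is) * (N ∸ length is * m)
        ≡⟨ cong (_* (N ∸ length is * m)) (length-transversals is) ⟩
      fallingProd N m (length is) * (N ∸ length is * m)
        ≡⟨ sym (fallingProd-suc N m (length is)) ⟩
      fallingProd N m (suc (length is)) ∎
      where
      open ≡-Reasoning
      choices : ∀ {Z} → Z ∈ transversals is → length (map (λ y → (i , y) ∷ Z) (filterᵇ (freshᵇ Z) (allFin (suc N)))) ≡ N ∸ length is * m
      choices {Z} Z∈ = let indices , tZ = transversals-sound is Z∈ in begin
        length (map (λ y → (i , y) ∷ Z) (filterᵇ (freshᵇ Z) (allFin (suc N)))) ≡⟨ length-map _ (filterᵇ (freshᵇ Z) (allFin (suc N))) ⟩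
        length (filterᵇ (freshᵇ Z) (allFin (suc N)))                          ≡⟨ length-filterᵇ (freshᵇ Z) (allFin (suc N)) ⟩
        count (freshᵇ Z) (allFin (suc N))                                     ≡⟨ count-fresh Z tZ ⟩
        N ∸ length Z * m                                                      ≡⟨ cong (λ l → N ∸ l * m) (trans (sym (length-map proj₁ Z)) (cong length indices)) ⟩
        N ∸ length is * m                                                     ∎

    sameValuesᵇ : List (I × V) → List (I × V) → Bool
    sameValuesᵇ [] [] = true
    sameValuesᵇ (p ∷ Z) (q ∷ Z') = (proj₂ p == proj₂ q) ∧ sameValuesᵇ Z Z'
    sameValuesᵇ [] (_ ∷ _) = false
    sameValuesᵇ (_ ∷ _) [] = false

    sameValuesᵇ-sound : ∀ Z Z' → map proj₁ Z ≡ map proj₁ Z' → T (sameValuesᵇ Z Z') → Z ≡ Z'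
    sameValuesᵇ-sound [] [] _ _ = refl
    sameValuesᵇ-sound ((i , y) ∷ Z) ((i' , y') ∷ Z') e t =
      let y=y' , rest = T∧⁻ {y == y'} t
          i≡i' , indices = ∷-injective e
      in cong₂ _∷_ (cong₂ _,_ i≡i' (==-sound y=y')) (sameValuesᵇ-sound Z Z' indices rest)

    sameValuesᵇ-refl : ∀ Z → T (sameValuesᵇ Z Z)
    sameValuesᵇ-refl [] = tt
    sameValuesᵇ-refl ((i , y) ∷ Z) = T∧ (==-refl y) (sameValuesᵇ-refl Z)

    transversals-exact : ∀ is Z → map proj₁ Z ≡ is → Transversal Z → count (λ Z' → sameValuesᵇ Z' Z) (transversals is) ≡ 1
    transversals-exact [] [] _ _ = refl
    transversals-exact (i ∷ is) ((i' , y₀) ∷ Z₀) e (y₀-fresh , tZ₀) = begin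
      count (λ Z' → sameValuesᵇ Z' ((i' , y₀) ∷ Z₀)) (transversals (i ∷ is))
        ≡⟨ count-concatMap (λ Z' → sameValuesᵇ Z' ((i' , y₀) ∷ Z₀)) _ (transversals is) ⟩
      _ ≡⟨ sum-map-cong (transversals is) (λ {Z'} Z'∈ →
             trans (count-map (λ Z'' → sameValuesᵇ Z'' ((i' , y₀) ∷ Z₀)) _ (filterᵇ (freshᵇ Z') (allFin (suc N))))
                   (trans (count-filterᵇ (freshᵇ Z') _ (allFin (suc N))) (extensions Z' Z'∈))) ⟩
      sum (map (λ Z' → ι (sameValuesᵇ Z' Z₀)) (transversals is))
        ≡⟨ sum-map-ι (λ Z' → sameValuesᵇ Z' Z₀) (transversals is) ⟩
      count (λ Z' → sameValuesᵇ Z' Z₀) (transversals is)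
        ≡⟨ transversals-exact is Z₀ (proj₂ (∷-injective e)) tZ₀ ⟩
      1 ∎
      where
      open ≡-Reasoning
      extensions : ∀ Z' → Z' ∈ transversals is → count (λ y → freshᵇ Z' y ∧ ((y == y₀) ∧ sameValuesᵇ Z' Z₀)) (allFin (suc N)) ≡ ι (sameValuesᵇ Z' Z₀)
      extensions Z' Z'∈ with sameValuesᵇ Z' Z₀ in eq
      ... | false = count-zero (allFin (suc N)) (λ {y} _ t → subst T (∧-zeroʳ (y == y₀)) (proj₂ (T∧⁻ {freshᵇ Z' y} t)))
      ... | true with sameValuesᵇ-sound Z' Z₀ (trans (proj₁ (transversals-sound is Z'∈)) (sym (proj₂ (∷-injective e)))) (subst T (sym eq) tt)
      ... | refl = count-allFin-1 (suc N) _ y₀ (T∧ (fresh-complete y₀-fresh) (T∧ (==-refl y₀) tt)) only-y₀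
        where
        only-y₀ : ∀ a b → T (freshᵇ Z' a ∧ ((a == y₀) ∧ true)) → T (freshᵇ Z' b ∧ ((b == y₀) ∧ true)) → a ≡ b
        only-y₀ a b ta tb = trans (==-sound (proj₁ (T∧⁻ {a == y₀} (proj₂ (T∧⁻ {freshᵇ Z' a} ta)))))
                                  (sym (==-sound (proj₁ (T∧⁻ {b == y₀} (proj₂ (T∧⁻ {freshᵇ Z' b} tb))))))

isEquivRel-complete : ∀ {n} (R : Rel₂ n) → (∀ a → T (R a a)) → (∀ {a b} → T (R a b) → T (R b a)) →
  (∀ {a b c} → T (R a b) → T (R b c) → T (R a c)) → T (isEquivRel R)
isEquivRel-complete R rfl sy tr =
  T∧ (allFin-intro rfl) (T∧ (allFin-intro (λ a → allFin-intro (λ b → symmetric a b)))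
                            (allFin-intro (λ a → allFin-intro (λ b → allFin-intro (λ c → transitive a b c)))))
  where
  symmetric : ∀ a b → T (not (R a b) ∨ R b a)
  symmetric a b with R a b in eq
  ... | false = tt
  ... | true = sy (subst T (sym eq) tt)
  transitive : ∀ a b c → T (not (R a b ∧ R b c) ∨ R a c)
  transitive a b c with R a b in e₁ | R b c in e₂
  ... | false | _ = tt
  ... | true | false = tt
  ... | true | true = tr (subst T (sym e₁) tt) (subst T (sym e₂) tt)

module Partition {n : ℕ} (R : Rel₂ n) (eqv : T (isEquivRel R)) where
  private
    laws = T∧⁻ {all (λ i → R i i) (allFin n)} eqv
    laws₂ = T∧⁻ {all (λ i → all (λ j → not (R i j) ∨ R j i) (allFin n)) (allFin n)} (proj₂ laws)

  R-refl : ∀ a → T (R a a)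
  R-refl = allFin-elim (proj₁ laws)

  R-sym : ∀ {a b} → T (R a b) → T (R b a)
  R-sym {a} {b} t with T∨⁻ {not (R a b)} (allFin-elim (allFin-elim (proj₁ laws₂) a) b)
  ... | inj₁ x = ⊥-elim (Tnot⁻ x t)
  ... | inj₂ y = y

  R-trans : ∀ {a b c} → T (R a b) → T (R b c) → T (R a c)
  R-trans {a} {b} {c} t u with T∨⁻ {not (R a b ∧ R b c)} (allFin-elim (allFin-elim (allFin-elim (proj₂ laws₂) a) b) c)
  ... | inj₁ x = ⊥-elim (Tnot⁻ x (T∧ t u))
  ... | inj₂ y = y

  same-block : ∀ {a b} → T (R a b) → ∀ y → R a y ≡ R b y
  same-block t y = T-ext (R-trans (R-sym t)) (R-trans t)

  isLeast-sound : ∀ {a} → T (isLeast R a) → ∀ j → T (R a j) → toℕ a ≤ toℕ j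
  isLeast-sound {a} t j u with T∨⁻ {not (R a j)} (allFin-elim t j)
  ... | inj₁ x = ⊥-elim (Tnot⁻ x u)
  ... | inj₂ y = ≤ᵇ⇒≤ (toℕ a) (toℕ j) y

  isLeast-complete : ∀ {a} → (∀ j → T (R a j) → toℕ a ≤ toℕ j) → T (isLeast R a)
  isLeast-complete {a} h = allFin-intro least
    where
    least : ∀ j → T (not (R a j) ∨ (toℕ a ≤ᵇ toℕ j))
    least j with R a j in eq
    ... | false = tt
    ... | true = ≤⇒≤ᵇ (h j (subst T (sym eq) tt))

  least-in-block : ∀ a → Σ (Fin n) λ a₀ → T (R a a₀) × T (isLeast R a₀)
  least-in-block a = let a₀ , a~a₀ , least = findMin (R a) a (R-refl a) in
    a₀ , a~a₀ , isLeast-complete (λ j u → least j (R-trans a~a₀ u))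

  least-unique : ∀ {a b} → T (isLeast R a) → T (isLeast R b) → T (R a b) → a ≡ b
  least-unique la lb t = toℕ-injective (≤-antisym (isLeast-sound la _ t) (isLeast-sound lb _ (R-sym t)))

  blocks-∈ : ∀ {a} → T (isLeast R a) → R a ∈ blocks R
  blocks-∈ {a} t = ∈-map⁺ R (∈-filterᵇ⁺ {q = isLeast R} {xs = allFin n} (∈-allFin a) t)

  blocks-∈⁻ : ∀ {A} → A ∈ blocks R → Σ (Fin n) λ a → A ≡ R a × T (isLeast R a)
  blocks-∈⁻ A∈ = let a , a∈ , e = ∈-map⁻ R A∈ in a , e , proj₂ (∈-filterᵇ⁻ {q = isLeast R} {xs = allFin n} a∈)

  count-blocks : (p : Subset n → Bool) → count p (blocks R) ≡ count (λ a → isLeast R a ∧ p (R a)) (allFin n)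
  count-blocks p = trans (count-map p R (filterᵇ (isLeast R) (allFin n))) (count-filterᵇ (isLeast R) (p ∘ R) (allFin n))

isEquivRel-resp : ∀ {n} {R K : Rel₂ n} → (∀ a b → R a b ≡ K a b) → T (isEquivRel K) → T (isEquivRel R)
isEquivRel-resp {R = R} {K} R≡K eqv =
  isEquivRel-complete R (λ a → from (K-refl a)) (λ t → from (K-sym (to t))) (λ t u → from (K-trans (to t) (to u)))
  where
  open Partition K eqv renaming (R-refl to K-refl; R-sym to K-sym; R-trans to K-trans)
  to : ∀ {a b} → T (R a b) → T (K a b)
  to = subst T (R≡K _ _)
  from : ∀ {a b} → T (K a b) → T (R a b)
  from = subst T (sym (R≡K _ _))

module Action (n : ℕ) (w : Permutation′ n) where
  π π⁻ : Fin n → Fin n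
  π j = w ⟨$⟩ʳ j
  π⁻ j = w ⟨$⟩ˡ j

  Π Π⁻ : ℕ → Fin n → Fin n
  Π s = π ^[ s ]
  Π⁻ s = π⁻ ^[ s ]

  Π-Π⁻ : ∀ s j → Π s (Π⁻ s j) ≡ j
  Π-Π⁻ zero j = refl
  Π-Π⁻ (suc s) j = trans (cong π (trans (cong (Π s) (iter-comm π⁻ s j)) (Π-Π⁻ s (π⁻ j)))) (inverseʳ w)

  img^-apply : ∀ s (A : Subset n) j → (img w ^[ s ]) A j ≡ A (Π⁻ s j)
  img^-apply zero A j = refl
  img^-apply (suc s) A j = trans (img^-apply s A (π⁻ j)) (cong A (sym (iter-comm π⁻ s j)))

module Admissibility (n : ℕ) (w : Permutation′ n) (m : ℕ) .{{_ : NonZero m}} (1<m : 1 < m)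
                     (R : Rel₂ n) (eqv : T (isEquivRel R)) where
  open Partition R eqv public
  open Action n w

  Invariant : Set
  Invariant = ∀ a b → R (π a) (π b) ≡ R a b

  Fixed : Fin n → Set
  Fixed a = T (R a (π a))

  LongOrbit : Fin n → Set
  LongOrbit a = (∀ u → 0 < u → u < m → ¬ T (R (Π u a) a)) × T (R (Π m a) a)

  record Admissible : Set where
    field
      invariant : Invariant
      fixed-or-long : ∀ a → Fixed a ⊎ LongOrbit a
      fixed-unique : ∀ a b → Fixed a → Fixed b → T (R a b)

  image-block : T (isInvariant w R) → ∀ a y → R a (π⁻ y) ≡ R (π a) y
  image-block t a y = begin
    R a (π⁻ y)    ≡⟨ same-block a~a₀ (π⁻ y) ⟩
    R a₀ (π⁻ y)   ≡⟨ image-is-block y ⟩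
    R b₀ y        ≡⟨ same-block b₀~πa y ⟩
    R (π a) y     ∎
    where
    open ≡-Reasoning
    a₀ = proj₁ (least-in-block a)
    a~a₀ = proj₁ (proj₂ (least-in-block a))
    is-block : T (isBlock R (img w (R a₀)))
    is-block = all-elim {xs = blocks R} (proj₁ (T∧⁻ {all (λ A → isBlock R (img w A)) (blocks R)} t)) (blocks-∈ (proj₂ (proj₂ (least-in-block a))))
    B = any-elim {xs = blocks R} is-block
    b₀ = proj₁ (blocks-∈⁻ (proj₁ (proj₂ B)))
    image-is-block : ∀ y → R a₀ (π⁻ y) ≡ R b₀ y
    image-is-block y = trans (sameSet-sound {A = img w (R a₀)} (proj₂ (proj₂ B)) y) (cong (λ Z → Z y) (proj₁ (proj₂ (blocks-∈⁻ (proj₁ (proj₂ B))))))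
    b₀~πa : T (R b₀ (π a))
    b₀~πa = subst T (trans (cong (R a₀) (sym (inverseˡ w))) (image-is-block (π a))) (R-sym a~a₀)

  invariant-sound : T (isInvariant w R) → Invariant
  invariant-sound t a b = sym (trans (cong (R a) (sym (inverseˡ w))) (image-block t a (π b)))

  isRepresentativeᵇ : Fin n → Bool
  isRepresentativeᵇ a = isLeast R a ∧ (orbitLengthExactly w m (R a) ∧ containsOrbitMin w m (R a))

  representatives : List (Fin n)
  representatives = filterᵇ isRepresentativeᵇ (allFin n)

  r≡length-representatives : r w m R ≡ length representatives
  r≡length-representatives = trans (length-filterᵇ _ (blocks R)) (trans (count-blocks _) (sym (length-filterᵇ isRepresentativeᵇ (allFin n))))

  representatives-unique : Unique representatives
  representatives-unique = filter⁺ (T? ∘ isRepresentativeᵇ) (allFin⁺ n)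

  module _ (inv : Invariant) where

    Π-invariant : ∀ s a b → R (Π s a) (Π s b) ≡ R a b
    Π-invariant zero a b = refl
    Π-invariant (suc s) a b = trans (inv (Π s a) (Π s b)) (Π-invariant s a b)

    img^-block : ∀ s a j → (img w ^[ s ]) (R a) j ≡ R (Π s a) j
    img^-block s a j = trans (img^-apply s (R a) j) (trans (sym (Π-invariant s a (Π⁻ s j))) (cong (R (Π s a)) (Π-Π⁻ s j)))

    isFixed-sound : ∀ {a} → T (isFixed w (R a)) → Fixed a
    isFixed-sound {a} t = subst T (sym (trans (sym (sameSet-sound {A = img w (R a)} t (π a))) (img^-block 1 a (π a)))) (R-refl (π a))

    isFixed-complete : ∀ {a} → Fixed a → T (isFixed w (R a))
    isFixed-complete {a} f = sameSet-complete {A = img w (R a)} (λ j → trans (img^-block 1 a j) (same-block (R-sym f) j))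

    Fixed-resp : ∀ {a b} → T (R a b) → Fixed a → Fixed b
    Fixed-resp {a} {b} t f = R-trans (R-sym t) (R-trans f (subst T (sym (inv a b)) t))

    same-image-sound : ∀ {a} s t → T (sameSet ((img w ^[ s ]) (R a)) ((img w ^[ t ]) (R a))) → T (R (Π s a) (Π t a))
    same-image-sound {a} s t h = subst T (trans (sym (img^-block t a (Π t a)))
      (trans (sym (sameSet-sound {A = (img w ^[ s ]) (R a)} h (Π t a))) (img^-block s a (Π t a)))) (R-refl (Π t a))

    same-image-complete : ∀ {a} s t → T (R (Π s a) (Π t a)) → T (sameSet ((img w ^[ s ]) (R a)) ((img w ^[ t ]) (R a)))
    same-image-complete {a} s t h = sameSet-complete {A = (img w ^[ s ]) (R a)}
      (λ j → trans (img^-block s a j) (trans (same-block h j) (sym (img^-block t a j))))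

    Π-shift : ∀ v s {a b} → T (R (Π s a) b) → T (R (Π (v + s) a) (Π v b))
    Π-shift v s {a} {b} x = subst T (trans (sym (Π-invariant v (Π s a) b)) (cong (λ z → R z (Π v b)) (sym (iter-+ π v s a)))) x

    LongOrbit-resp : ∀ {a b} → T (R a b) → LongOrbit a → LongOrbit b
    LongOrbit-resp {a} {b} t (short , period) = (λ u u>0 u<m x → short u u>0 u<m (from-b u x)) , to-b m period
      where
      to-b : ∀ u → T (R (Π u a) a) → T (R (Π u b) b)
      to-b u x = R-trans (subst T (sym (Π-invariant u b a)) (R-sym t)) (R-trans x t)
      from-b : ∀ u → T (R (Π u b) b) → T (R (Π u a) a)
      from-b u x = R-trans (subst T (sym (Π-invariant u a b)) t) (R-trans x (R-sym t))

    LongOrbit-π : ∀ {a} → LongOrbit a → LongOrbit (π a)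
    LongOrbit-π {a} (short , period) = (λ u u>0 u<m x → short u u>0 u<m (subst T (shifted u) x)) , subst T (sym (shifted m)) period
      where
      shifted : ∀ u → R (Π u (π a)) (π a) ≡ R (Π u a) a
      shifted u = trans (cong (λ z → R z (π a)) (sym (iter-comm π u a))) (inv (Π u a) a)

    LongOrbit-Π : ∀ s {a} → LongOrbit a → LongOrbit (Π s a)
    LongOrbit-Π zero e = e
    LongOrbit-Π (suc s) e = LongOrbit-π (LongOrbit-Π s e)

    LongOrbit⇒¬Fixed : ∀ {a} → LongOrbit a → ¬ Fixed a
    LongOrbit⇒¬Fixed (short , _) f = short 1 (s≤s z≤n) 1<m (R-sym f)

    LongOrbit-period : ∀ {a} → LongOrbit a → ∀ q → T (R (Π (q * m) a) a)
    LongOrbit-period e zero = R-refl _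
    LongOrbit-period {a} e (suc q) = subst (λ z → T (R z a)) (sym (iter-+ π m (q * m) a))
      (R-trans (subst T (sym (Π-invariant m (Π (q * m) a) a)) (LongOrbit-period e q)) (proj₂ e))

    LongOrbit-mod : ∀ {a} → LongOrbit a → ∀ s y → R (Π s a) y ≡ R (Π (s % m) a) y
    LongOrbit-mod {a} e s y = begin
      R (Π s a) y                                 ≡⟨ cong (λ z → R (Π z a) y) (m≡m%n+[m/n]*n s m) ⟩
      R (Π (s % m + s / m * m) a) y               ≡⟨ cong (λ z → R z y) (iter-+ π (s % m) (s / m * m) a) ⟩
      R (Π (s % m) (Π (s / m * m) a)) y           ≡⟨ same-block (subst T (sym (Π-invariant (s % m) (Π (s / m * m) a) a)) (LongOrbit-period e (s / m))) y ⟩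
      R (Π (s % m) a) y                           ∎
      where open ≡-Reasoning

    private
      LongOrbit-distinct-≤ : ∀ {a} → LongOrbit a → ∀ s t → s ≤ t → t < m → T (R (Π s a) (Π t a)) → s ≡ t
      LongOrbit-distinct-≤ {a} (short , _) s t s≤t t<m x with t ∸ s in t∸s
      ... | zero = sym (trans (sym (m+[n∸m]≡n s≤t)) (trans (cong (s +_) t∸s) (+-identityʳ s)))
      ... | suc u = ⊥-elim (short (suc u) (s≤s z≤n) (≤-<-trans (subst (_≤ t) t∸s (m∸n≤m t s)) t<m) (R-sym a~Πa))
        where
        a~Πa : T (R a (Π (suc u) a))
        a~Πa = subst T (trans (cong (λ z → R (Π s a) (Π z a)) (trans (sym (m+[n∸m]≡n s≤t)) (cong (s +_) t∸s)))
                              (trans (cong (R (Π s a)) (iter-+ π s (suc u) a)) (Π-invariant s a (Π (suc u) a)))) x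

    LongOrbit-distinct : ∀ {a} → LongOrbit a → ∀ s t → s < m → t < m → T (R (Π s a) (Π t a)) → s ≡ t
    LongOrbit-distinct e s t s<m t<m x with ≤-total s t
    ... | inj₁ s≤t = LongOrbit-distinct-≤ e s t s≤t t<m x
    ... | inj₂ t≤s = sym (LongOrbit-distinct-≤ e t s t≤s s<m (R-sym x))

    orbitLength-sound : ∀ {a} → T (orbitLengthExactly w m (R a)) → LongOrbit a
    orbitLength-sound {a} t = (λ u u>0 u<m x → differs u u>0 (all-elim {xs = upTo m} (all-elim {xs = upTo m} distinct (∈-upTo⁺ u<m)) (∈-upTo⁺ {n = m} {i = 0} (<-trans (s≤s z≤n) 1<m))) x) ,
                              subst T (trans (sym (sameSet-sound {A = (img w ^[ m ]) (R a)} closes a)) (img^-block m a a)) (R-refl a)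
      where
      parts = T∧⁻ {all (λ s → all (λ t → (s ≡ᵇ t) ∨ not (sameSet ((img w ^[ s ]) (R a)) ((img w ^[ t ]) (R a)))) (upTo m)) (upTo m)} t
      distinct = proj₁ parts
      closes = proj₂ parts
      differs : ∀ u → 0 < u → T ((u ≡ᵇ 0) ∨ not (sameSet ((img w ^[ u ]) (R a)) ((img w ^[ 0 ]) (R a)))) → ¬ T (R (Π u a) a)
      differs (suc u) _ h x = Tnot⁻ h (same-image-complete (suc u) 0 x)

    orbitLength-complete : ∀ {a} → LongOrbit a → T (orbitLengthExactly w m (R a))
    orbitLength-complete {a} e = T∧ (all-intro {xs = upTo m} (λ {s} s∈ → all-intro {xs = upTo m} (λ {t} t∈ → distinct s t (∈-upTo⁻ s∈) (∈-upTo⁻ t∈))))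
                                    (sameSet-complete {A = (img w ^[ m ]) (R a)} (λ j → trans (img^-block m a j) (same-block (proj₂ e) j)))
      where
      distinct : ∀ s t → s < m → t < m → T ((s ≡ᵇ t) ∨ not (sameSet ((img w ^[ s ]) (R a)) ((img w ^[ t ]) (R a))))
      distinct s t s<m t<m with sameSet ((img w ^[ s ]) (R a)) ((img w ^[ t ]) (R a)) in eq
      ... | false = T∨ʳ (s ≡ᵇ t) tt
      ... | true = T∨ˡ false (≡⇒≡ᵇ s t (LongOrbit-distinct e s t s<m t<m (same-image-sound s t (subst T (sym eq) tt))))

    OrbitMinimal : Fin n → Set
    OrbitMinimal a = ∀ t → t < m → ∀ y → T (R (Π t a) y) → toℕ a ≤ toℕ y

    Representative : Fin n → Set
    Representative a = LongOrbit a × OrbitMinimal a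

    containsOrbitMin-sound : ∀ {a} → T (isLeast R a) → T (containsOrbitMin w m (R a)) → OrbitMinimal a
    containsOrbitMin-sound {a} la t = λ t' t'<m y x → subst (_≤ toℕ y) i≡a (below t' t'<m y x)
      where
      witness = any-elim {xs = allFin n} t
      i = proj₁ witness
      parts = T∧⁻ {R a i} (proj₂ (proj₂ witness))
      below : ∀ t → t < m → ∀ y → T (R (Π t a) y) → toℕ i ≤ toℕ y
      below t t<m y x with T∨⁻ {not ((img w ^[ t ]) (R a) y)} (allFin-elim (all-elim {xs = upTo m} (proj₂ parts) (∈-upTo⁺ t<m)) y)
      ... | inj₁ z = ⊥-elim (Tnot⁻ z (subst T (sym (img^-block t a y)) x))
      ... | inj₂ z = ≤ᵇ⇒≤ (toℕ i) (toℕ y) z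
      i≡a : toℕ i ≡ toℕ a
      i≡a = ≤-antisym (below 0 (<-trans (s≤s z≤n) 1<m) a (R-refl a)) (isLeast-sound la i (proj₁ parts))

    containsOrbitMin-complete : ∀ {a} → OrbitMinimal a → T (containsOrbitMin w m (R a))
    containsOrbitMin-complete {a} h = any-intro {xs = allFin n} (∈-allFin a)
      (T∧ (R-refl a) (all-intro {xs = upTo m} (λ {t} t∈ → allFin-intro (below t (∈-upTo⁻ t∈)))))
      where
      below : ∀ t → t < m → ∀ y → T (not ((img w ^[ t ]) (R a) y) ∨ (toℕ a ≤ᵇ toℕ y))
      below t t<m y with (img w ^[ t ]) (R a) y in eq
      ... | false = tt
      ... | true = ≤⇒≤ᵇ (h t t<m y (subst T (trans (sym eq) (img^-block t a y)) tt))

    representative-sound : ∀ {a} → T (isRepresentativeᵇ a) → Representative a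
    representative-sound {a} t = let least , rest = T∧⁻ {isLeast R a} t
                                     long , minimal = T∧⁻ {orbitLengthExactly w m (R a)} rest
                                 in orbitLength-sound long , containsOrbitMin-sound least minimal

    representative-complete : ∀ {a} → Representative a → T (isRepresentativeᵇ a)
    representative-complete {a} (e , h) =
      T∧ (isLeast-complete (h 0 (<-trans (s≤s z≤n) 1<m))) (T∧ (orbitLength-complete e) (containsOrbitMin-complete h))

    isInvariant-complete : T (isInvariant w R)
    isInvariant-complete = T∧ (all-intro {xs = blocks R} image-is-block) (all-intro {xs = blocks R} preimage-is-block)
      where
      image-is-block : ∀ {A} → A ∈ blocks R → T (isBlock R (img w A))
      image-is-block A∈ with blocks-∈⁻ A∈
      ... | a₀ , refl , _ = let b , πa₀~b , lb = least-in-block (π a₀) in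
        any-intro {xs = blocks R} (blocks-∈ lb) (sameSet-complete {A = img w (R a₀)} (λ j → trans (img^-block 1 a₀ j) (same-block πa₀~b j)))
      preimage-is-block : ∀ {B} → B ∈ blocks R → T (any (λ A → sameSet (img w A) B) (blocks R))
      preimage-is-block B∈ with blocks-∈⁻ B∈
      ... | b₀ , refl , _ = let a , π⁻b₀~a , la = least-in-block (π⁻ b₀) in
        any-intro {xs = blocks R} (blocks-∈ la) (sameSet-complete {A = img w (R a)} (λ j → trans (img^-block 1 a j)
          (same-block (R-sym (subst T (trans (sym (inv (π⁻ b₀) a)) (cong (λ z → R z (π a)) (inverseʳ w))) π⁻b₀~a)) j)))

  admissible-complete : Admissible → T (isAdmissible w m R)
  admissible-complete adm = T∧ (isInvariant-complete invariant) (T∧ at-most-one-fixed (all-intro {xs = blocks R} fixed-or-long-block))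
    where
    open Admissible adm
    unique-least-fixed : ∀ x y → T (isLeast R x ∧ isFixed w (R x)) → T (isLeast R y ∧ isFixed w (R y)) → x ≡ y
    unique-least-fixed x y tx ty = let lx , fx = T∧⁻ {isLeast R x} tx ; ly , fy = T∧⁻ {isLeast R y} ty in
      least-unique lx ly (fixed-unique x y (isFixed-sound invariant fx) (isFixed-sound invariant fy))
    at-most-one-fixed : T (length (filterᵇ (isFixed w) (blocks R)) ≤ᵇ 1)
    at-most-one-fixed = ≤⇒≤ᵇ (subst (_≤ 1) (sym (trans (length-filterᵇ (isFixed w) (blocks R)) (count-blocks (isFixed w))))
                               (count-allFin-≤1 n _ unique-least-fixed))
    fixed-or-long-block : ∀ {A} → A ∈ blocks R → T (isFixed w A ∨ orbitLengthExactly w m A)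
    fixed-or-long-block A∈ with blocks-∈⁻ A∈
    ... | a₀ , refl , _ with fixed-or-long a₀
    ... | inj₁ f = T∨ˡ _ (isFixed-complete invariant f)
    ... | inj₂ e = T∨ʳ (isFixed w (R a₀)) (orbitLength-complete invariant e)

  admissible-sound : T (isAdmissible w m R) → Admissible
  admissible-sound t = record { invariant = inv ; fixed-or-long = fixed-or-long ; fixed-unique = fixed-unique }
    where
    parts = T∧⁻ {isInvariant w R} t
    parts₂ = T∧⁻ {length (filterᵇ (isFixed w) (blocks R)) ≤ᵇ 1} (proj₂ parts)
    inv = invariant-sound (proj₁ parts)
    fixed-or-long : ∀ a → Fixed a ⊎ LongOrbit a
    fixed-or-long a with least-in-block a
    ... | a₀ , a~a₀ , la₀ with T∨⁻ {isFixed w (R a₀)} (all-elim {xs = blocks R} (proj₂ parts₂) (blocks-∈ la₀))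
    ... | inj₁ f = inj₁ (Fixed-resp inv (R-sym a~a₀) (isFixed-sound inv f))
    ... | inj₂ e = inj₂ (LongOrbit-resp inv (R-sym a~a₀) (orbitLength-sound inv e))
    -- two fixed blocks would give two least elements of fixed blocks
    fixed-unique : ∀ a b → Fixed a → Fixed b → T (R a b)
    fixed-unique a b fa fb with least-in-block a | least-in-block b
    ... | a₀ , a~a₀ , la₀ | b₀ , b~b₀ , lb₀ with a₀ ≟ b₀
    ... | yes refl = R-trans a~a₀ (R-sym b~b₀)
    ... | no a₀≢b₀ = ⊥-elim (<⇒≱ (s≤s (s≤s z≤n)) (≤-trans
            (count-allFin-≥2 n (λ x → isLeast R x ∧ isFixed w (R x)) a₀ b₀
                (T∧ la₀ (isFixed-complete inv (Fixed-resp inv a~a₀ fa))) (T∧ lb₀ (isFixed-complete inv (Fixed-resp inv b~b₀ fb))) a₀≢b₀)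
            (subst (_≤ 1) (trans (length-filterᵇ (isFixed w) (blocks R)) (count-blocks (isFixed w))) (≤ᵇ⇒≤ _ 1 (proj₁ parts₂)))))

  module Orbits (adm : Admissible) where
    open Admissible adm

    long-of-¬fixed : ∀ {j} → ¬ Fixed j → LongOrbit j
    long-of-¬fixed {j} nf with fixed-or-long j
    ... | inj₁ f = ⊥-elim (nf f)
    ... | inj₂ e = e

    private
      -- j in the block of π^t b returns to b's block after (m-1) t more steps
      back : ∀ {a b t} → LongOrbit b → T (R (Π t b) a) → T (R (Π (((m ∸ 1) * t) % m) a) b)
      back {a} {b} {t} eb x = subst T (LongOrbit-mod invariant (LongOrbit-resp invariant x (LongOrbit-Π invariant t eb)) ((m ∸ 1) * t) b)
                                     (R-sym (R-trans (R-sym (LongOrbit-period invariant eb t)) around))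
        where
        around : T (R (Π (t * m) b) (Π ((m ∸ 1) * t) a))
        around = subst (λ z → T (R (Π z b) (Π ((m ∸ 1) * t) a))) ([m∸1]*s+s≡s*m m t (<-trans (s≤s z≤n) 1<m)) (Π-shift invariant ((m ∸ 1) * t) t x)

      below-representative : ∀ {i i' s s'} → Representative invariant i → Representative invariant i' → T (R (Π s i) (Π s' i')) → toℕ i ≤ toℕ i'
      below-representative {i} {i'} {s} {s'} (ei , min-i) (ei' , _) x = min-i ((v + s) % m) (m%n<n _ m) i' in-orbit
        where
        v = (m ∸ 1) * s'
        shifted : T (R (Π (v + s) i) (Π (v + s') i'))
        shifted = subst T (trans (sym (Π-invariant invariant v (Π s i) (Π s' i')))
                                 (cong₂ R (sym (iter-+ π v s i)) (sym (iter-+ π v s' i')))) x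
        in-orbit : T (R (Π ((v + s) % m) i) i')
        in-orbit = subst T (LongOrbit-mod invariant ei (v + s) i')
          (R-trans (subst (λ z → T (R (Π (v + s) i) (Π z i'))) ([m∸1]*s+s≡s*m m s' (<-trans (s≤s z≤n) 1<m)) shifted) (LongOrbit-period invariant ei' s'))

    representative-unique : ∀ {i i' s s' j} → Representative invariant i → Representative invariant i' → s < m → s' < m →
      T (R (Π s i) j) → T (R (Π s' i') j) → i ≡ i' × s ≡ s'
    representative-unique {i} {i'} {s} {s'} ri ri' s<m s'<m x x' with toℕ-injective (≤-antisym
        (below-representative {s = s} {s' = s'} ri ri' (R-trans x (R-sym x')))
        (below-representative {s = s'} {s' = s} ri' ri (R-trans x' (R-sym x))))
    ... | refl = refl , LongOrbit-distinct invariant (proj₁ ri) s s' s<m s'<m (R-trans x (R-sym x'))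

    -- the representative of j is the least element of the union of the orbit of j's block
    representative-exists : ∀ j → ¬ Fixed j → Σ (Fin n) λ i → Σ ℕ λ s → Representative invariant i × s < m × T (R (Π s i) j)
    representative-exists j nf = i , ((m ∸ 1) * t) % m , (ei , minimal) , m%n<n _ m , back ej rt
      where
      ej = long-of-¬fixed nf
      in-orbit-of-j : Fin n → Bool
      in-orbit-of-j y = any (λ t → R (Π t j) y) (upTo m)
      least = findMin in-orbit-of-j j (any-intro {xs = upTo m} (∈-upTo⁺ (<-trans (s≤s z≤n) 1<m)) (R-refl j))
      i = proj₁ least
      found = any-elim {xs = upTo m} (proj₁ (proj₂ least))
      t = proj₁ found
      rt : T (R (Π t j) i)
      rt = proj₂ (proj₂ found)
      ei : LongOrbit i
      ei = LongOrbit-resp invariant rt (LongOrbit-Π invariant t ej)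
      minimal : OrbitMinimal invariant i
      minimal t' t'<m y x = proj₂ (proj₂ least) y (any-intro {xs = upTo m} (∈-upTo⁺ (m%n<n (t' + t) m))
        (subst T (LongOrbit-mod invariant ej (t' + t) y) (R-trans (Π-shift invariant t' t rt) x)))

    representative-¬fixed : ∀ {i s j} → Representative invariant i → T (R (Π s i) j) → ¬ Fixed j
    representative-¬fixed {s = s} ri x f = LongOrbit⇒¬Fixed invariant (LongOrbit-Π invariant s (proj₁ ri)) (Fixed-resp invariant (R-sym x) f)

pairs-functional : ∀ {I V : Set} (Z : List (I × V)) → Unique (map proj₁ Z) → ∀ {i x x'} → (i , x) ∈ Z → (i , x') ∈ Z → x ≡ x'
pairs-functional (p ∷ Z) u (here refl) (here refl) = refl
pairs-functional (p ∷ Z) u (here refl) (there mem) = ⊥-elim (Unique[x∷xs]⇒x∉xs u (∈-map⁺ proj₁ mem))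
pairs-functional (p ∷ Z) u (there mem) (here refl) = ⊥-elim (Unique[x∷xs]⇒x∉xs u (∈-map⁺ proj₁ mem))
pairs-functional (p ∷ Z) (_ ∷ u) (there mem) (there mem') = pairs-functional Z u mem mem'

-- Assembling a function from a partition R and a tuple Z of (representative, value)
-- pairs: j gets the value G^s x if j lies in the block of π^s i for some (i , x) in Z
-- and s < m, and 0 otherwise.

module Assembly (n : ℕ) (w : Permutation′ n) (N : ℕ) {{_ : NonZero N}} (d m : ℕ)
                (d>0 : 0 < d) (d<N : d < N) (m-def : m * gcd N d ≡ N) where
  open Transversals N d m d>0 d<N m-def public
  open Action n w public

  search : Rel₂ n → ℕ → Fin n → V → Fin n → Maybe V
  search R zero i x j = nothing
  search R (suc t) i x j with search R t i x j
  ... | just v = just v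
  ... | nothing = if R (Π t i) j then just ((G ^[ t ]) x) else nothing

  search-just : ∀ R t i x j {v} → search R t i x j ≡ just v → Σ ℕ λ s → s < t × T (R (Π s i) j) × v ≡ (G ^[ s ]) x
  search-just R (suc t) i x j e with search R t i x j in eq
  ... | just v' = let s , s<t , r , e' = search-just R t i x j eq in s , m≤n⇒m≤1+n s<t , r , trans (sym (just-injective e)) e'
  ... | nothing with R (Π t i) j in eq₂
  ... | true = t , ≤-refl , subst T (sym eq₂) tt , sym (just-injective e)

  search-nothing : ∀ R t i x j → search R t i x j ≡ nothing → ∀ s → s < t → ¬ T (R (Π s i) j)
  search-nothing R (suc t) i x j e s s<t r with search R t i x j in eq
  search-nothing R (suc t) i x j () s s<t r | just _
  ... | nothing with R (Π t i) j in eq₂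
  ... | false with s ≟ℕ t
  ... | yes refl = subst T eq₂ r
  ... | no s≢t = search-nothing R t i x j eq s (≤∧≢⇒< (≤-pred s<t) s≢t) r

  assemble : Rel₂ n → List (Fin n × V) → Fin n → V
  assemble R [] j = zero
  assemble R ((i , x) ∷ Z) j = fromMaybe (assemble R Z j) (search R m i x j)

  assemble-outside : ∀ R Z j → (∀ {p} → p ∈ Z → ∀ s → s < m → ¬ T (R (Π s (proj₁ p)) j)) → assemble R Z j ≡ zero
  assemble-outside R [] j h = refl
  assemble-outside R ((i , x) ∷ Z) j h with search R m i x j in eq
  ... | just v = let s , s<m , r , _ = search-just R m i x j eq in ⊥-elim (h (here refl) s s<m r)
  ... | nothing = assemble-outside R Z j (h ∘ there)

  assemble-inside : ∀ R Z j →
    (∀ {i i' x x' s s'} → (i , x) ∈ Z → (i' , x') ∈ Z → s < m → s' < m → T (R (Π s i) j) → T (R (Π s' i') j) → (G ^[ s ]) x ≡ (G ^[ s' ]) x') →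
    ∀ {i x s} → (i , x) ∈ Z → s < m → T (R (Π s i) j) → assemble R Z j ≡ (G ^[ s ]) x
  assemble-inside R ((i₀ , x₀) ∷ Z) j consistent mem s<m r with search R m i₀ x₀ j in eq
  ... | just v = let s₀ , s₀<m , r₀ , e₀ = search-just R m i₀ x₀ j eq in trans e₀ (consistent (here refl) mem s₀<m s<m r₀ r)
  ... | nothing with mem
  ... | here refl = ⊥-elim (search-nothing R m i₀ x₀ j eq _ s<m r)
  ... | there mem' = assemble-inside R Z j (λ a b → consistent (there a) (there b)) mem' s<m r

  module _ (R : Rel₂ n) (eqv : T (isEquivRel R)) where
    open Admissibility n w m 1<m R eqv

    module Assembled (adm : Admissible) (Z : List (Fin n × V)) (indices : map proj₁ Z ≡ representatives) (tZ : Transversal Z) where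
      open Admissible adm
      open Orbits adm

      f : Fin n → V
      f = assemble R Z

      Z-representative : ∀ {i x} → (i , x) ∈ Z → Representative invariant i
      Z-representative mem = representative-sound invariant
        (proj₂ (∈-filterᵇ⁻ {q = isRepresentativeᵇ} {xs = allFin n} (subst (_ ∈_) indices (∈-map⁺ proj₁ mem))))

      Z-functional : ∀ {i x x'} → (i , x) ∈ Z → (i , x') ∈ Z → x ≡ x'
      Z-functional = pairs-functional Z (subst Unique (sym indices) representatives-unique)

      Z-covers : ∀ {i} → Representative invariant i → Σ V λ x → (i , x) ∈ Z
      Z-covers {i} ri with ∈-map⁻ proj₁ (subst (_ ∈_) (sym indices)
                             (∈-filterᵇ⁺ {q = isRepresentativeᵇ} {xs = allFin n} (∈-allFin i) (representative-complete invariant ri)))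
      ... | (i' , x) , mem , refl = x , mem

      f-at : ∀ {i x s j} → (i , x) ∈ Z → s < m → T (R (Π s i) j) → f j ≡ (G ^[ s ]) x
      f-at {j = j} = assemble-inside R Z j consistent
        where
        consistent : ∀ {i i' x x' s s'} → (i , x) ∈ Z → (i' , x') ∈ Z → s < m → s' < m → T (R (Π s i) j) → T (R (Π s' i') j) → (G ^[ s ]) x ≡ (G ^[ s' ]) x'
        consistent {s = s} mem mem' s<m s'<m r r' with representative-unique (Z-representative mem) (Z-representative mem') s<m s'<m r r'
        ... | refl , refl = cong (G ^[ s ]) (Z-functional mem mem')

      f-fixed : ∀ {j} → Fixed j → f j ≡ zero
      f-fixed {j} fj = assemble-outside R Z j (λ {p} p∈ s s<m r → representative-¬fixed {s = s} (Z-representative p∈) r fj)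

      f-representative : ∀ {i x} → (i , x) ∈ Z → f i ≡ x
      f-representative mem = f-at mem (<-trans (s≤s z≤n) 1<m) (R-refl _)

      Located : Fin n → Set
      Located j = Σ (Fin n) λ i → Σ V λ x → Σ ℕ λ s → (i , x) ∈ Z × s < m × T (R (Π s i) j)

      locate : ∀ j → Fixed j ⊎ Located j
      locate j with T? (R j (π j))
      ... | yes fj = inj₁ fj
      ... | no nf = let i , s , ri , s<m , r = representative-exists j nf
                        x , mem = Z-covers ri in inj₂ (i , x , s , mem , s<m , r)

      f-equivariant : ∀ j → f (π j) ≡ G (f j)
      f-equivariant j with locate j
      ... | inj₁ fj = trans (f-fixed (Fixed-resp invariant fj fj)) (trans (sym (G^-zero 1)) (cong G (sym (f-fixed fj))))
      ... | inj₂ (i , x , s , mem , s<m , r) = begin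
        f (π j)                ≡⟨ f-at mem (m%n<n (suc s) m) (subst T (LongOrbit-mod invariant (proj₁ (Z-representative mem)) (suc s) (π j))
                                                                   (subst T (sym (invariant (Π s i) j)) r)) ⟩
        (G ^[ suc s % m ]) x   ≡⟨ sym (G^-mod (suc s) x) ⟩
        G ((G ^[ s ]) x)       ≡⟨ cong G (sym (f-at mem s<m r)) ⟩
        G (f j)                ∎
        where open ≡-Reasoning

      f-kernel : ∀ a b → (f a == f b) ≡ R a b
      f-kernel a b = T-ext same-value⇒related related⇒same-value
        where
        related⇒same-value : T (R a b) → T (f a == f b)
        related⇒same-value ab with locate a
        ... | inj₁ fa = ==-complete (trans (f-fixed fa) (sym (f-fixed (Fixed-resp invariant ab fa))))
        ... | inj₂ (i , x , s , mem , s<m , r) = ==-complete (trans (f-at mem s<m r) (sym (f-at mem s<m (R-trans r ab))))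
        nonzero : ∀ {i x s j} → (i , x) ∈ Z → s < m → T (R (Π s i) j) → f j ≢ zero
        nonzero {x = x} {s} mem s<m r e = G^-nonzero s x (transversal-nonzero Z tZ mem) (trans (sym (f-at mem s<m r)) e)
        same-value⇒related : T (f a == f b) → T (R a b)
        same-value⇒related e with ==-sound e | locate a | locate b
        ... | fa=fb | inj₁ fa | inj₁ fb = fixed-unique a b fa fb
        ... | fa=fb | inj₁ fa | inj₂ (i , x , s , mem , s<m , r) = ⊥-elim (nonzero mem s<m r (trans (sym fa=fb) (f-fixed fa)))
        ... | fa=fb | inj₂ (i , x , s , mem , s<m , r) | inj₁ fb = ⊥-elim (nonzero mem s<m r (trans fa=fb (f-fixed fb)))
        ... | fa=fb | inj₂ (i , x , s , mem , s<m , r) | inj₂ (i' , x' , s' , mem' , s'<m , r') with i ≟ i'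
        ...   | no i≢i' = ⊥-elim (transversal-distinct Z tZ mem mem' i≢i' (Orb-trans (s , refl) (Orb-sym (s' , values))))
          where
          values : (G ^[ s ]) x ≡ (G ^[ s' ]) x'
          values = trans (sym (f-at mem s<m r)) (trans fa=fb (f-at mem' s'<m r'))
        ...   | yes refl with Z-functional mem mem'
        ...     | refl = R-trans (R-sym r) (subst (λ z → T (R (Π z i) b)) (sym s≡s') r')
          where
          s≡s' : s ≡ s'
          s≡s' = G^-distinct x (transversal-nonzero Z tZ mem) s<m s'<m (trans (sym (f-at mem s<m r)) (trans fa=fb (f-at mem' s'<m r')))

module Equivariance (n : ℕ) (w : Permutation′ n) (N : ℕ) {{_ : NonZero N}} (d m : ℕ)
                    (d>0 : 0 < d) (d<N : d < N) (m-def : m * gcd N d ≡ N) where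
  open Assembly n w N d m d>0 d<N m-def public

  equivariant-sound : ∀ {f} → T (isEquivariant w d f) → ∀ j → f (π j) ≡ G (f j)
  equivariant-sound t j = ==-sound (allFin-elim t j)

  equivariant-complete : ∀ {f} → (∀ j → f (π j) ≡ G (f j)) → T (isEquivariant w d f)
  equivariant-complete h = allFin-intro (==-complete ∘ h)

  -- 0 is the only fixed point of G, because m > 1
  G-fixed⇒zero : ∀ y → G y ≡ y → y ≡ zero
  G-fixed⇒zero zero _ = refl
  G-fixed⇒zero (suc x) e = ⊥-elim (<⇒≱ 1<m (∣⇒≤ (G^-stabiliser 1 (suc x) (λ ()) e)))

  ==-G : ∀ x y → (G x == G y) ≡ (x == y)
  ==-G x y = T-ext (λ t → ==-complete (G^-injective 1 (==-sound t))) (λ t → ==-complete (cong G (==-sound t)))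

  module Kernel (f : Fin n → V) (f-equivariant : ∀ j → f (π j) ≡ G (f j)) where

    f-Π : ∀ s j → f (Π s j) ≡ (G ^[ s ]) (f j)
    f-Π zero j = refl
    f-Π (suc s) j = trans (f-equivariant (Π s j)) (cong G (f-Π s j))

    kernel : Rel₂ n
    kernel a b = f a == f b

    kernel-equivalence : T (isEquivRel kernel)
    kernel-equivalence = isEquivRel-complete kernel (λ a → ==-refl (f a)) (λ t → ==-complete (sym (==-sound t)))
                                                   (λ t u → ==-complete (trans (==-sound t) (==-sound u)))

    -- Everything below holds for any R with the same truth values as the kernel.
    module _ (R : Rel₂ n) (eqv : T (isEquivRel R)) (R≡kernel : ∀ a b → R a b ≡ kernel a b) where
      open Admissibility n w m 1<m R eqv

      related : ∀ {a b} → f a ≡ f b → T (R a b)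
      related {a} {b} e = subst T (sym (R≡kernel a b)) (==-complete e)

      same-value : ∀ {a b} → T (R a b) → f a ≡ f b
      same-value {a} {b} t = ==-sound (subst T (R≡kernel a b) t)

      fixed⇒zero : ∀ {a} → Fixed a → f a ≡ zero
      fixed⇒zero {a} fa = G-fixed⇒zero (f a) (sym (trans (same-value fa) (f-equivariant a)))

      zero⇒fixed : ∀ {a} → f a ≡ zero → Fixed a
      zero⇒fixed {a} fa≡0 = related (trans fa≡0 (sym (trans (f-equivariant a) (trans (cong G fa≡0) (G^-zero 1)))))

      kernel-admissible : Admissible
      kernel-admissible = record { invariant = invariant ; fixed-or-long = fixed-or-long
                                 ; fixed-unique = λ a b fa fb → related (trans (fixed⇒zero fa) (sym (fixed⇒zero fb))) }
        where
        invariant : Invariant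
        invariant a b = begin
          R (π a) (π b)          ≡⟨ R≡kernel (π a) (π b) ⟩
          (f (π a) == f (π b))   ≡⟨ cong₂ _==_ (f-equivariant a) (f-equivariant b) ⟩
          (G (f a) == G (f b))   ≡⟨ ==-G (f a) (f b) ⟩
          (f a == f b)           ≡⟨ sym (R≡kernel a b) ⟩
          R a b                  ∎
          where open ≡-Reasoning
        -- a nonzero value has a G-orbit of length m, so its block has a w-orbit of length m
        fixed-or-long : ∀ a → Fixed a ⊎ LongOrbit a
        fixed-or-long a with f a ≟ zero
        ... | yes fa≡0 = inj₁ (zero⇒fixed fa≡0)
        ... | no fa≢0 = inj₂ (short , related (trans (f-Π m a) (G^-period m ∣-refl (f a))))
          where
          short : ∀ u → 0 < u → u < m → ¬ T (R (Π u a) a)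
          short u u>0 u<m x = <⇒≢ u>0 (sym (G^-distinct (f a) fa≢0 u<m 0<m (trans (sym (f-Π u a)) (same-value x))))

      open Admissible kernel-admissible
      open Orbits kernel-admissible

      values : List (Fin n) → List (Fin n × V)
      values = map (λ i → (i , f i))

      values-indices : ∀ L → map proj₁ (values L) ≡ L
      values-indices L = trans (sym (map-∘ L)) (map-id L)

      values-transversal : (L : List (Fin n)) → Unique L → (∀ {i} → i ∈ L → Representative invariant i) → Transversal (values L)
      values-transversal [] _ _ = tt
      values-transversal (i ∷ L) u@(_ ∷ u') rep = (fi≢0 , other-orbits) , values-transversal L u' (rep ∘ there)
        where
        fi≢0 : f i ≢ zero
        fi≢0 fi≡0 = LongOrbit⇒¬Fixed invariant (proj₁ (rep (here refl))) (zero⇒fixed fi≡0)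
        other-orbits : ∀ {p} → p ∈ values L → ¬ Orb (proj₂ p) (f i)
        other-orbits p∈ (s , e) with ∈-map⁻ (λ i → (i , f i)) p∈
        ... | i' , i'∈L , refl = Unique[x∷xs]⇒x∉xs u (subst (_∈ L) (proj₁ same-rep) i'∈L)
          where
          ri' = rep (there i'∈L)
          reach : T (R (Π s i') i)
          reach = related (trans (f-Π s i') (sym e))
          same-rep = representative-unique ri' (rep (here refl)) (m%n<n s m) (<-trans (s≤s z≤n) 1<m)
                       (subst T (LongOrbit-mod invariant (proj₁ ri') s i) reach) (R-refl i)

      Z₀ : List (Fin n × V)
      Z₀ = values representatives

      Z₀-transversal : Transversal Z₀
      Z₀-transversal = values-transversal representatives representatives-unique
        (λ i∈ → representative-sound invariant (proj₂ (∈-filterᵇ⁻ {q = isRepresentativeᵇ} {xs = allFin n} i∈)))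

      module A₀ = Assembled R eqv kernel-admissible Z₀ (values-indices representatives) Z₀-transversal

      assemble-values : ∀ j → assemble R Z₀ j ≡ f j
      assemble-values j with A₀.locate j
      ... | inj₁ fj = trans (A₀.f-fixed fj) (sym (fixed⇒zero fj))
      ... | inj₂ (i , x , s , mem , s<m , r) with ∈-map⁻ (λ i → (i , f i)) mem
      ...   | _ , _ , refl = trans (A₀.f-at mem s<m r) (trans (sym (f-Π s i)) (same-value r))

      values-determined : (Z : List (Fin n × V)) → map proj₁ Z ≡ representatives → Transversal Z →
                          (∀ j → assemble R Z j ≡ f j) → Z ≡ Z₀
      values-determined Z indices tZ assembled≡f = begin
        Z                            ≡⟨ as-values Z (λ {i} {x} mem → trans (sym (f-representative mem)) (assembled≡f i)) ⟩
        values (map proj₁ Z)         ≡⟨ cong values indices ⟩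
        Z₀                           ∎
        where
        open ≡-Reasoning
        open Assembled R eqv kernel-admissible Z indices tZ using (f-representative)
        as-values : (Z : List (Fin n × V)) → (∀ {i x} → (i , x) ∈ Z → x ≡ f i) → Z ≡ values (map proj₁ Z)
        as-values [] h = refl
        as-values ((i , x) ∷ Z) h = cong₂ _∷_ (cong (i ,_) (h (here refl))) (as-values Z (h ∘ there))

      exactly-one-tuple : count (λ Z → allEq _==_ f (assemble R Z)) (transversals representatives) ≡ 1
      exactly-one-tuple = trans (count-cong (transversals representatives) (λ {Z} Z∈ → matches-Z₀ Z Z∈))
                                (transversals-exact representatives Z₀ (values-indices representatives) Z₀-transversal)
        where
        matches-Z₀ : ∀ Z → Z ∈ transversals representatives → allEq _==_ f (assemble R Z) ≡ sameValuesᵇ Z Z₀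
        matches-Z₀ Z Z∈ = T-ext to from
          where
          indices = proj₁ (transversals-sound representatives Z∈)
          tZ = proj₂ (transversals-sound representatives Z∈)
          to : T (allEq _==_ f (assemble R Z)) → T (sameValuesᵇ Z Z₀)
          to t = subst (λ z → T (sameValuesᵇ z Z₀)) (sym (values-determined Z indices tZ (λ j → sym (==-sound (allEq-sound {eq = _==_} t j))))) (sameValuesᵇ-refl Z₀)
          from : T (sameValuesᵇ Z Z₀) → T (allEq _==_ f (assemble R Z))
          from t with sameValuesᵇ-sound Z Z₀ (trans indices (sym (values-indices representatives))) t
          ... | refl = allEq-intro {eq = _==_} (λ j → ==-complete (sym (assemble-values j)))

module DoubleCount (n k : ℕ) (n≥1 : 1 ≤ n) (k≥1 : 1 ≤ k) (w : Permutation′ n) (d : ℕ) (d>0 : 0 < d) (d<N : d < k * n)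
                   (m : ℕ) (m-def : m * gcd (k * n) d ≡ k * n) where
  instance
    N-nonZero : NonZero (k * n)
    N-nonZero = >-nonZero (*-mono-≤ k≥1 n≥1)

  open Equivariance n w (k * n) d m d>0 d<N m-def

  admissibleᵇ : Rel₂ n → Bool
  admissibleᵇ = isAdmissible w m

  admissibles : List (Rel₂ n)
  admissibles = filterᵇ admissibleᵇ (setPartitions n)

  partition-equivalence : ∀ {R} → R ∈ setPartitions n → T (isEquivRel R)
  partition-equivalence R∈ = proj₂ (∈-filterᵇ⁻ {q = isEquivRel} {xs = allFunsFrom (allFunsFrom (true ∷ false ∷ []) n) n} R∈)

  -- the list `Admissibility.representatives`, which depends on R only
  representatives-of : Rel₂ n → List (Fin n)
  representatives-of R = filterᵇ (λ a → isLeast R a ∧ (orbitLengthExactly w m (R a) ∧ containsOrbitMin w m (R a))) (allFin n)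

  assembledFrom : Rel₂ n → List (Fin n → V)
  assembledFrom R = map (assemble R) (transversals (representatives-of R))

  assembled : List (Fin n → V)
  assembled = concatMap assembledFrom admissibles

  equivariants : List (Fin n → V)
  equivariants = filterᵇ (isEquivariant w d) (allFuns n (suc (k * n)))

  equalᵇ : (Fin n → V) → (Fin n → V) → Bool
  equalᵇ = allEq _==_

  length-assembled : length assembled ≡ rhs n k w m
  length-assembled = trans (length-concatMap assembledFrom admissibles) (sum-map-cong admissibles per-partition)
    where
    per-partition : ∀ {R} → R ∈ admissibles → length (assembledFrom R) ≡ fallingProd (k * n) m (r w m R)
    per-partition {R} R∈ = begin
      length (assembledFrom R)                                  ≡⟨ length-map (assemble R) (transversals (representatives-of R)) ⟩
      length (transversals (representatives-of R))              ≡⟨ length-transversals (representatives-of R) ⟩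
      fallingProd (k * n) m (length (representatives-of R))     ≡⟨ cong (fallingProd (k * n) m) (sym r≡length-representatives) ⟩
      fallingProd (k * n) m (r w m R)                           ∎
      where
      open ≡-Reasoning
      open Admissibility n w m 1<m R (partition-equivalence (proj₁ (∈-filterᵇ⁻ {q = admissibleᵇ} {xs = setPartitions n} R∈))) using (r≡length-representatives)

  assembled-∈⁻ : ∀ {h} → h ∈ assembled → Σ (Rel₂ n) λ R → Σ (List (Fin n × V)) λ Z →
                 R ∈ admissibles × Z ∈ transversals (representatives-of R) × h ≡ assemble R Z
  assembled-∈⁻ h∈ with ∈-concat⁻′ (map assembledFrom admissibles) h∈
  ... | L , h∈L , L∈ with ∈-map⁻ assembledFrom L∈
  ... | R , R∈ , refl with ∈-map⁻ (assemble R) h∈L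
  ... | Z , Z∈ , refl = R , Z , R∈ , Z∈ , refl

  equivariant-resp : ∀ {h g} → T (equalᵇ h g) → T (isEquivariant w d h) → T (isEquivariant w d g)
  equivariant-resp {h} {g} h=g eh = equivariant-complete (λ j → begin
    g (π j)     ≡⟨ sym (==-sound (allEq-sound {eq = _==_} h=g (π j))) ⟩
    h (π j)     ≡⟨ equivariant-sound eh j ⟩
    G (h j)     ≡⟨ cong G (==-sound (allEq-sound {eq = _==_} h=g j)) ⟩
    G (g j)     ∎)
    where open ≡-Reasoning

  allFuns-exact : ∀ h → count (λ g → equalᵇ g h) (allFuns n (suc (k * n))) ≡ 1
  allFuns-exact h = allFunsFrom-exact _==_ (allFin (suc (k * n))) n h (λ j → count-allFin-== (suc (k * n)) (h j))

  assembled-once : ∀ {h} → h ∈ assembled → count (equalᵇ h) equivariants ≡ 1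
  assembled-once {h} h∈ with assembled-∈⁻ h∈
  ... | R , Z , R∈ , Z∈ , refl = begin
    count (equalᵇ h) equivariants                                          ≡⟨ count-filterᵇ (isEquivariant w d) (equalᵇ h) allFs ⟩
    count (λ g → isEquivariant w d g ∧ equalᵇ h g) allFs                  ≡⟨ count-cong allFs equal-and-equivariant ⟩
    count (λ g → equalᵇ g h) allFs                                         ≡⟨ allFuns-exact h ⟩
    1                                                                      ∎
    where
    open ≡-Reasoning
    allFs = allFuns n (suc (k * n))
    R∈' = ∈-filterᵇ⁻ {q = admissibleᵇ} {xs = setPartitions n} R∈
    eqv = partition-equivalence (proj₁ R∈')
    open Admissibility n w m 1<m R eqv using (admissible-sound)
    tZ = transversals-sound (representatives-of R) Z∈
    h-equivariant : T (isEquivariant w d h)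
    h-equivariant = equivariant-complete (Assembled.f-equivariant R eqv (admissible-sound (proj₂ R∈')) Z (proj₁ tZ) (proj₂ tZ))
    equal-and-equivariant : ∀ {g} → g ∈ allFs → (isEquivariant w d g ∧ equalᵇ h g) ≡ equalᵇ g h
    equal-and-equivariant {g} _ with equalᵇ h g in e
    ... | false = trans (∧-zeroʳ _) (trans (sym e) (allEq-sym _==_ ==-sym h g))
    ... | true = trans (∧-identityʳ _) (trans (T⇒≡true (equivariant-resp (subst T (sym e) tt) h-equivariant))
                                              (trans (sym e) (allEq-sym _==_ ==-sym h g)))

  sameRelᵇ : Rel₂ n → Rel₂ n → Bool
  sameRelᵇ = allEq (allEq eqB)

  sameRelᵇ-sound : ∀ {R K} → T (sameRelᵇ R K) → ∀ a b → R a b ≡ K a b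
  sameRelᵇ-sound {R} {K} t a b = eqB-sound (allEq-sound {eq = eqB} {g = R a} {f = K a} (allEq-sound {eq = allEq eqB} {g = R} {f = K} t a) b)

  sameRelᵇ-complete : ∀ {R K} → (∀ a b → R a b ≡ K a b) → T (sameRelᵇ R K)
  sameRelᵇ-complete {R} {K} h = allEq-intro {eq = allEq eqB} {g = R} {f = K}
    (λ a → allEq-intro {eq = eqB} {g = R a} {f = K a} (λ b → subst (λ z → T (eqB (R a b) z)) (h a b) (eqB-refl (R a b))))

  partition-once : (K : Rel₂ n) → T (isEquivRel K) → count (λ R → sameRelᵇ R K) (setPartitions n) ≡ 1
  partition-once K K-equivalence = begin
    count (λ R → sameRelᵇ R K) (setPartitions n)        ≡⟨ count-filterᵇ isEquivRel (λ R → sameRelᵇ R K) allRels ⟩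
    count (λ R → isEquivRel R ∧ sameRelᵇ R K) allRels   ≡⟨ count-cong allRels only-equivalences ⟩
    count (λ R → sameRelᵇ R K) allRels                  ≡⟨ allFunsFrom-exact (allEq eqB) (allFunsFrom bools n) n K
                                                             (λ i → allFunsFrom-exact eqB bools n (K i) (λ j → bools-exact (K i j))) ⟩
    1                                                   ∎
    where
    open ≡-Reasoning
    bools : List Bool
    bools = true ∷ false ∷ []
    allRels : List (Rel₂ n)
    allRels = allFunsFrom (allFunsFrom bools n) n
    bools-exact : ∀ b → count (λ a → eqB a b) bools ≡ 1
    bools-exact true = refl
    bools-exact false = refl
    only-equivalences : ∀ {R} → R ∈ allRels → (isEquivRel R ∧ sameRelᵇ R K) ≡ sameRelᵇ R K
    only-equivalences {R} _ with sameRelᵇ R K in e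
    ... | false = ∧-zeroʳ (isEquivRel R)
    ... | true = trans (∧-identityʳ (isEquivRel R)) (T⇒≡true (isEquivRel-resp {R = R} {K} (sameRelᵇ-sound (subst T (sym e) tt)) K-equivalence))

  copies-from : (f : Fin n → V) (f-equivariant : ∀ j → f (π j) ≡ G (f j)) → ∀ {R} → R ∈ setPartitions n →
    (if admissibleᵇ R then count (equalᵇ f) (assembledFrom R) else 0) ≡ ι (sameRelᵇ R (Kernel.kernel f f-equivariant))
  copies-from f f-equivariant {R} R∈ with sameRelᵇ R kernel in e
    where open Kernel f f-equivariant
  ... | true = begin
    (if admissibleᵇ R then count (equalᵇ f) (assembledFrom R) else 0)
      ≡⟨ cong (λ c → if c then count (equalᵇ f) (assembledFrom R) else 0) (T⇒≡true R-admissible) ⟩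
    count (equalᵇ f) (assembledFrom R)
      ≡⟨ count-map (equalᵇ f) (assemble R) (transversals (representatives-of R)) ⟩
    count (λ Z → equalᵇ f (assemble R Z)) (transversals (representatives-of R))
      ≡⟨ exactly-one-tuple R eqv R≡kernel ⟩
    1 ∎
    where
    open ≡-Reasoning
    open Kernel f f-equivariant
    eqv = partition-equivalence R∈
    R≡kernel = sameRelᵇ-sound (subst T (sym e) tt)
    R-admissible = Admissibility.admissible-complete n w m 1<m R eqv (kernel-admissible R eqv R≡kernel)
  ... | false with admissibleᵇ R in a
  ... | false = refl
  ... | true = trans (count-map (equalᵇ f) (assemble R) (transversals (representatives-of R))) (count-zero _ not-f)
    where
    open Kernel f f-equivariant
    eqv = partition-equivalence R∈
    open Admissibility n w m 1<m R eqv using (admissible-sound)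
    -- a function assembled from R has kernel R, which differs from the kernel of f
    not-f : ∀ {Z} → Z ∈ transversals (representatives-of R) → ¬ T (equalᵇ f (assemble R Z))
    not-f {Z} Z∈ t = subst T e (sameRelᵇ-complete (λ a b → trans (sym (f-kernel a b)) (cong₂ _==_ (f≡ a) (f≡ b))))
      where
      tZ = transversals-sound (representatives-of R) Z∈
      open Assembled R eqv (admissible-sound (subst T (sym a) tt)) Z (proj₁ tZ) (proj₂ tZ) using (f-kernel)
      f≡ : ∀ j → assemble R Z j ≡ f j
      f≡ j = sym (==-sound (allEq-sound {eq = _==_} t j))

  equivariant-once : ∀ {f} → f ∈ equivariants → count (equalᵇ f) assembled ≡ 1
  equivariant-once {f} f∈ = begin
    count (equalᵇ f) assembled
      ≡⟨ count-concatMap (equalᵇ f) assembledFrom admissibles ⟩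
    sum (map (λ R → count (equalᵇ f) (assembledFrom R)) admissibles)
      ≡⟨ sum-map-filterᵇ admissibleᵇ _ (setPartitions n) ⟩
    sum (map (λ R → if admissibleᵇ R then count (equalᵇ f) (assembledFrom R) else 0) (setPartitions n))
      ≡⟨ sum-map-cong (setPartitions n) (copies-from f f-equivariant) ⟩
    sum (map (λ R → ι (sameRelᵇ R kernel)) (setPartitions n))
      ≡⟨ sum-map-ι (λ R → sameRelᵇ R kernel) (setPartitions n) ⟩
    count (λ R → sameRelᵇ R kernel) (setPartitions n)
      ≡⟨ partition-once kernel kernel-equivalence ⟩
    1 ∎
    where
    open ≡-Reasoning
    f-equivariant = equivariant-sound (proj₂ (∈-filterᵇ⁻ {q = isEquivariant w d} {xs = allFuns n (suc (k * n))} f∈))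
    open Kernel f f-equivariant

lemma8p4 : (n k : ℕ) → 1 ≤ n → 1 ≤ k → (w : Permutation′ n) → (d : ℕ) → 0 < d → d < k * n →
    (m : ℕ) → m * gcd (k * n) d ≡ k * n →
    numEquivariant n k w d ≡ rhs n k w m
lemma8p4 n k n≥1 k≥1 w d d>0 d<kn m m-def = begin
  numEquivariant n k w d   ≡⟨⟩
  length equivariants      ≡⟨ exact-length equalᵇ (allEq-sym _==_ ==-sym) equivariants assembled equivariant-once assembled-once ⟩
  length assembled         ≡⟨ length-assembled ⟩
  rhs n k w m              ∎
  where
  open ≡-Reasoning
  open DoubleCount n k n≥1 k≥1 w d d>0 d<kn m m-def
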